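{- Let $\phi_1,\phi_2,\dots$, $u$ and $X$ be indeterminates, $\Phi(z)=1+\phi_1z+\phi_2z^2+\cdots$, and $R$ the ring of polynomials in the $\phi_i$, $u$ and $u^{ -1}$. Let $Z(u,y)\in R[[y]]$ be the unique formal power series solution $F=f_1y+f_2y^2+\cdots$ (no constant term) of $F^2\Phi(F)-2yF+(1-u^2)y^2=0$ with $f_1=1-u$, and let $Z(-u,y)$ be obtained by replacing $u$ with $-u$. Then in the ring $R((X))[[y]]$ of formal power series in $y$ whose coefficients are formal Laurent series in $X$ over $R$, we have \[\Phi(X)-\frac{2y}{X}+\frac{(1-u^2)y^2}{X^2}=\left(1-\frac{Z(u,y)}{X}\right)\left(1-\frac{Z(-u,y)}{X}\right)T\] for some $T\in R[[X,y]]$ whose constant term (in $X$ and $y$) is $1$.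
   Context: $R((X))[[y]]$ consists of series $\sum_{i\in\mathbb Z}\sum_{j\ge0}a_{ij}X^iy^j$ with $a_{ij}\in R$ such that for each $j$, $a_{ij}=0$ for all but finitely many negative $i$. -}

module Defs where

open import Level using (0ℓ)
open import Data.Nat using (ℕ; zero; suc; _∸_) renaming (_+_ to _+ℕ_)
open import Data.Integer as ℤ using (ℤ; +_; -[1+_])
open import Data.Rational as ℚ using (ℚ)
open import Data.Product using (_,_)
open import Relation.Binary.Structures using (IsEquivalence)
open import Algebra.Structures
open import Algebra.Bundles using (CommutativeRing)

-- The coefficient ring  R = ℚ[φ₁, φ₂, …, u, u⁻¹],
-- presented as the commutative ℚ-algebra generated by φᵢ (i ≥ 1),
-- u and v subject to the single relation u·v = 1.

infixl 6 _⊕_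
infixl 7 _⊗_
infix 4 _~_

data Tm : Set where
  con  : ℚ → Tm
  phi  : ℕ → Tm          -- phi i  stands for  φ_(i+1)
  U    : Tm
  Uinv : Tm
  _⊕_  : Tm → Tm → Tm
  _⊗_  : Tm → Tm → Tm
  ⊖_   : Tm → Tm

𝟘 𝟙 : Tm
𝟘 = con ℚ.0ℚ
𝟙 = con ℚ.1ℚ

data _~_ : Tm → Tm → Set where
  ~refl  : ∀ {a} → a ~ a
  ~sym   : ∀ {a b} → a ~ b → b ~ a
  ~trans : ∀ {a b c} → a ~ b → b ~ c → a ~ c
  ⊕-cong : ∀ {a b c d} → a ~ b → c ~ d → a ⊕ c ~ b ⊕ d
  ⊗-cong : ∀ {a b c d} → a ~ b → c ~ d → a ⊗ c ~ b ⊗ d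
  ⊖-cong : ∀ {a b} → a ~ b → ⊖ a ~ ⊖ b
  ⊕-assoc : ∀ a b c → (a ⊕ b) ⊕ c ~ a ⊕ (b ⊕ c)
  ⊕-idˡ   : ∀ a → 𝟘 ⊕ a ~ a
  ⊕-idʳ   : ∀ a → a ⊕ 𝟘 ~ a
  ⊖-invˡ  : ∀ a → (⊖ a) ⊕ a ~ 𝟘
  ⊖-invʳ  : ∀ a → a ⊕ (⊖ a) ~ 𝟘
  ⊕-comm  : ∀ a b → a ⊕ b ~ b ⊕ a
  ⊗-assoc : ∀ a b c → (a ⊗ b) ⊗ c ~ a ⊗ (b ⊗ c)
  ⊗-idˡ   : ∀ a → 𝟙 ⊗ a ~ a
  ⊗-idʳ   : ∀ a → a ⊗ 𝟙 ~ a
  distribˡ : ∀ a b c → a ⊗ (b ⊕ c) ~ (a ⊗ b) ⊕ (a ⊗ c)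
  distribʳ : ∀ a b c → (b ⊕ c) ⊗ a ~ (b ⊗ a) ⊕ (c ⊗ a)
  ⊗-comm  : ∀ a b → a ⊗ b ~ b ⊗ a
  con-+   : ∀ p q → con (p ℚ.+ q) ~ con p ⊕ con q
  con-*   : ∀ p q → con (p ℚ.* q) ~ con p ⊗ con q
  u-inv   : U ⊗ Uinv ~ 𝟙

R-isCommutativeRing : IsCommutativeRing _~_ _⊕_ _⊗_ ⊖_ 𝟘 𝟙
R-isCommutativeRing = record
  { isRing = record
    { +-isAbelianGroup = record
      { isGroup = record
        { isMonoid = record
          { isSemigroup = record
            { isMagma = record
              { isEquivalence = record { refl = ~refl ; sym = ~sym ; trans = ~trans }
              ; ∙-cong = ⊕-cong }
            ; assoc = ⊕-assoc }
          ; identity = ⊕-idˡ , ⊕-idʳ }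
        ; inverse = ⊖-invˡ , ⊖-invʳ
        ; ⁻¹-cong = ⊖-cong }
      ; comm = ⊕-comm }
    ; *-cong = ⊗-cong
    ; *-assoc = ⊗-assoc
    ; *-identity = ⊗-idˡ , ⊗-idʳ
    ; distrib = distribˡ , distribʳ }
  ; *-comm = ⊗-comm }

R : CommutativeRing 0ℓ 0ℓ
R = record { isCommutativeRing = R-isCommutativeRing }

σ : Tm → Tm
σ (con q)  = con q
σ (phi i)  = phi i
σ U        = ⊖ U
σ Uinv     = ⊖ Uinv
σ (a ⊕ b)  = σ a ⊕ σ b
σ (a ⊗ b)  = σ a ⊗ σ b
σ (⊖ a)    = ⊖ σ a

module Series {c ℓ} (𝓡 : CommutativeRing c ℓ) where
  open CommutativeRing 𝓡

  infixl 6 _+ₚ_ _+L_ _+LP_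
  infixl 7 _*ₚ_ _*L_ _*LP_
  infix 4 _≈ₚ_ _≈L_ _≈LP_

  Σ< : ℕ → (ℕ → Carrier) → Carrier
  Σ< zero    f = 0#
  Σ< (suc n) f = Σ< n f + f n

  PS : Set c
  PS = ℕ → Carrier

  _≈ₚ_ : PS → PS → Set ℓ
  f ≈ₚ g = ∀ n → f n ≈ g n

  _+ₚ_ : PS → PS → PS
  (f +ₚ g) n = f n + g n

  -ₚ_ : PS → PS
  (-ₚ f) n = - f n

  _*ₚ_ : PS → PS → PS
  (f *ₚ g) n = Σ< (suc n) (λ k → f k * g (n ∸ k))

  constₚ : Carrier → PS
  constₚ a zero    = a
  constₚ a (suc n) = 0#

  varₚ : PS
  varₚ 1 = 1#
  varₚ _ = 0#

  _^ₚ_ : PS → ℕ → PS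
  f ^ₚ zero  = constₚ 1#
  f ^ₚ suc k = f *ₚ (f ^ₚ k)

  -- composition  A(F) = Σ_k a_k Fᵏ, for F without constant term
  -- (then only k ≤ n contribute to the coefficient of tⁿ)
  compₚ : PS → PS → PS
  compₚ a F n = Σ< (suc n) (λ k → a k * (F ^ₚ k) n)

  -- Laurent series Σ_k cf k · X^(k - ord)
  record Laurent : Set c where
    field
      ord : ℕ
      cf  : ℕ → Carrier
  open Laurent public

  atℤ : (ℕ → Carrier) → ℤ → Carrier
  atℤ f (+ n)    = f n
  atℤ f -[1+ n ] = 0#

  coefL : Laurent → ℤ → Carrier
  coefL L i = atℤ (cf L) (i ℤ.+ + ord L)

  _≈L_ : Laurent → Laurent → Set ℓ
  A ≈L B = ∀ i → coefL A i ≈ coefL B i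

  -- Laurent series with no terms below X^(-N), given by its coefficients
  mkL : ℕ → (ℤ → Carrier) → Laurent
  mkL N g = record { ord = N ; cf = λ k → g (+ k ℤ.- + N) }

  _+L_ : Laurent → Laurent → Laurent
  A +L B = mkL (ord A +ℕ ord B) (λ i → coefL A i + coefL B i)

  -L_ : Laurent → Laurent
  -L A = record { ord = ord A ; cf = λ k → - cf A k }

  _*L_ : Laurent → Laurent → Laurent
  A *L B = record { ord = ord A +ℕ ord B ; cf = cf A *ₚ cf B }

  fromPS : PS → Laurent
  fromPS f = record { ord = 0 ; cf = f }

  scalarL : Carrier → Laurent
  scalarL a = fromPS (constₚ a)

  0L : Laurent
  0L = scalarL 0#

  Xinv : Laurent
  Xinv = record { ord = 1 ; cf = constₚ 1# }

  ΣL< : ℕ → (ℕ → Laurent) → Laurent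
  ΣL< zero    f = 0L
  ΣL< (suc n) f = ΣL< n f +L f n

  -- R((X))[[y]] :  F n = coefficient of yⁿ, a Laurent series in X
  LPS : Set c
  LPS = ℕ → Laurent

  _≈LP_ : LPS → LPS → Set ℓ
  F ≈LP G = ∀ n → F n ≈L G n

  _+LP_ : LPS → LPS → LPS
  (F +LP G) n = F n +L G n

  -LP_ : LPS → LPS
  (-LP F) n = -L F n

  _*LP_ : LPS → LPS → LPS
  (F *LP G) n = ΣL< (suc n) (λ k → F k *L G (n ∸ k))

  constLP : Laurent → LPS
  constLP A zero    = A
  constLP A (suc n) = 0L

  yLP : LPS
  yLP 1 = scalarL 1#
  yLP _ = 0L

  ιy : PS → LPS
  ιy f n = scalarL (f n)

  -- R[[X,y]] ⊂ R((X))[[y]];  T j i = coefficient of Xⁱ yʲ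
  ιXy : (ℕ → ℕ → Carrier) → LPS
  ιXy T j = fromPS (T j)

open Series R public

Φ : PS
Φ zero    = 𝟙
Φ (suc i) = phi i

two : Tm
two = 𝟙 ⊕ 𝟙

zEqn : PS → PS
zEqn F = ((F *ₚ F) *ₚ compₚ Φ F)
         +ₚ (-ₚ ((constₚ two *ₚ varₚ) *ₚ F))
         +ₚ ((constₚ (𝟙 ⊕ (⊖ (U ⊗ U))) *ₚ varₚ) *ₚ varₚ)

lhs : LPS
lhs = constLP (fromPS Φ)
      +LP (-LP ((constLP (scalarL two) *LP yLP) *LP constLP Xinv))
      +LP (((constLP (scalarL (𝟙 ⊕ (⊖ (U ⊗ U)))) *LP yLP) *LP yLP)
             *LP constLP (Xinv *L Xinv))

oneMinusOverX : PS → LPS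
oneMinusOverX F = constLP (scalarL 𝟙) +LP (-LP (ιy F *LP constLP Xinv))

module Submission where

-- Regard P = X²Φ(X) − 2yX + (1 − u²)y² as a power series in X over R[[y]]. The equation
-- defining Z says that X = Z(u,y) is a root of P, and applying u ↦ −u shows that
-- X = Z(−u,y) is a root as well. The factor theorem splits off X − Z(u,y), leaving a
-- quotient Q with (Z(−u,y) − Z(u,y)) Q(Z(−u,y)) = 0; since Z(−u,y) − Z(u,y) = 2uy + O(y²)
-- is y times a unit, Q(Z(−u,y)) = 0 and a second division gives
-- P = (X − Z(u,y)) (X − Z(−u,y)) T, where T(0,0) = 1 is the coefficient of X² y⁰ in P.
-- Dividing by X² in R((X))[[y]] yields the identity.

open import Algebra.Bundles using (AbelianGroup; CommutativeRing; RawRing)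
open import Algebra.Structures using (IsCommutativeRing)
open import Data.Nat as ℕ using (ℕ; zero; suc; _∸_; _<_; _≤_; z≤n; s≤s)
import Data.Nat.Properties as ℕ
open import Data.Integer as ℤ using (ℤ; +_; -[1+_])
import Data.Integer.Properties as ℤ
open import Data.Maybe using (Maybe; just; nothing)
open import Data.Product using (Σ; _×_; _,_)
open import Data.Sign as Sign using (Sign)
open import Data.Rational using (½)
open import Relation.Binary.PropositionalEquality as ≡ using (_≡_)
open import Relation.Nullary using (yes; no)
open import Relation.Binary.Bundles using (Setoid)

module IntegerCoefficientSolver {c ℓ} (𝓡 : CommutativeRing c ℓ) where
  open CommutativeRing 𝓡
  open import Algebra.Properties.Ring ring
    using (-0#≈0#; -‿involutive; -‿+-comm; -‿distribˡ-*; -‿distribʳ-*)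
  open import Algebra.Properties.CommutativeSemigroup +-commutativeSemigroup using (interchange)
  open import Algebra.Properties.Semiring.Mult.TCOptimised semiring
    using (1+×; ×-homo-+; ×1-homo-*) renaming (_×_ to _×ᵤ_)
  import Algebra.Solver.Ring.AlmostCommutativeRing as ACR
  open import Relation.Binary.Reasoning.Setoid setoid

  ⟦_⟧ : ℤ → Carrier
  ⟦ + n ⟧      = n ×ᵤ 1#
  ⟦ -[1+ n ] ⟧ = - (suc n ×ᵤ 1#)

  ⟦⊖⟧ : ∀ m n → ⟦ m ℤ.⊖ n ⟧ ≈ m ×ᵤ 1# - n ×ᵤ 1#
  ⟦⊖⟧ zero    zero    = sym (trans (+-congˡ -0#≈0#) (+-identityʳ 0#))
  ⟦⊖⟧ zero    (suc n) = sym (+-identityˡ _)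
  ⟦⊖⟧ (suc m) zero    = sym (trans (+-congˡ -0#≈0#) (+-identityʳ _))
  ⟦⊖⟧ (suc m) (suc n) = begin
    ⟦ suc m ℤ.⊖ suc n ⟧                ≡⟨ ≡.cong ⟦_⟧ (ℤ.[1+m]⊖[1+n]≡m⊖n m n) ⟩
    ⟦ m ℤ.⊖ n ⟧                        ≈⟨ ⟦⊖⟧ m n ⟩
    m ×ᵤ 1# - n ×ᵤ 1#                    ≈⟨ +-identityˡ _ ⟨
    0# + (m ×ᵤ 1# - n ×ᵤ 1#)             ≈⟨ +-congʳ (-‿inverseʳ 1#) ⟨
    (1# - 1#) + (m ×ᵤ 1# - n ×ᵤ 1#)      ≈⟨ interchange 1# (- 1#) (m ×ᵤ 1#) (- (n ×ᵤ 1#)) ⟩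
    (1# + m ×ᵤ 1#) + (- 1# - n ×ᵤ 1#)    ≈⟨ +-congˡ (-‿+-comm 1# (n ×ᵤ 1#)) ⟩
    (1# + m ×ᵤ 1#) - (1# + n ×ᵤ 1#)      ≈⟨ +-cong (1+× m 1#) (-‿cong (1+× n 1#)) ⟨
    suc m ×ᵤ 1# - suc n ×ᵤ 1#            ∎

  ⟦+⟧ : ∀ i j → ⟦ i ℤ.+ j ⟧ ≈ ⟦ i ⟧ + ⟦ j ⟧
  ⟦+⟧ (+ m)    (+ n)    = ×-homo-+ 1# m n
  ⟦+⟧ (+ m)    -[1+ n ] = ⟦⊖⟧ m (suc n)
  ⟦+⟧ -[1+ m ] (+ n)    = trans (⟦⊖⟧ n (suc m)) (+-comm _ _)
  ⟦+⟧ -[1+ m ] -[1+ n ] = begin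
    - (suc (suc (m ℕ.+ n)) ×ᵤ 1#)        ≡⟨ ≡.cong (λ k → - (k ×ᵤ 1#)) (≡.sym (ℕ.+-suc (suc m) n)) ⟩
    - ((suc m ℕ.+ suc n) ×ᵤ 1#)          ≈⟨ -‿cong (×-homo-+ 1# (suc m) (suc n)) ⟩
    - (suc m ×ᵤ 1# + suc n ×ᵤ 1#)         ≈⟨ -‿+-comm _ _ ⟨
    - (suc m ×ᵤ 1#) - (suc n ×ᵤ 1#)       ∎

  ⟦-⟧ : ∀ i → ⟦ ℤ.- i ⟧ ≈ - ⟦ i ⟧
  ⟦-⟧ (+ zero)  = sym -0#≈0#
  ⟦-⟧ (+ suc n) = refl
  ⟦-⟧ -[1+ n ]  = sym (-‿involutive _)

  signed : Sign → Carrier → Carrier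
  signed Sign.+ x = x
  signed Sign.- x = - x

  signed-cong : ∀ s {x y} → x ≈ y → signed s x ≈ signed s y
  signed-cong Sign.+ e = e
  signed-cong Sign.- e = -‿cong e

  ⟦◃⟧ : ∀ s n → ⟦ s ℤ.◃ n ⟧ ≈ signed s (n ×ᵤ 1#)
  ⟦◃⟧ Sign.- zero    = sym -0#≈0#
  ⟦◃⟧ Sign.- (suc n) = refl
  ⟦◃⟧ Sign.+ zero    = refl
  ⟦◃⟧ Sign.+ (suc n) = refl

  ⟦⟧-signAbs : ∀ i → ⟦ i ⟧ ≈ signed (ℤ.sign i) (ℤ.∣ i ∣ ×ᵤ 1#)
  ⟦⟧-signAbs i = trans (reflexive (≡.cong ⟦_⟧ (≡.sym (ℤ.◃-inverse i)))) (⟦◃⟧ (ℤ.sign i) ℤ.∣ i ∣)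

  signed-* : ∀ s t x y → signed (s Sign.* t) (x * y) ≈ signed s x * signed t y
  signed-* Sign.+ Sign.+ x y = refl
  signed-* Sign.+ Sign.- x y = -‿distribʳ-* x y
  signed-* Sign.- Sign.+ x y = -‿distribˡ-* x y
  signed-* Sign.- Sign.- x y =
    trans (sym (-‿involutive _)) (trans (-‿cong (-‿distribˡ-* x y)) (-‿distribʳ-* _ _))

  ⟦*⟧ : ∀ i j → ⟦ i ℤ.* j ⟧ ≈ ⟦ i ⟧ * ⟦ j ⟧
  ⟦*⟧ i j = begin
    ⟦ s ℤ.◃ ∣i∣ ℕ.* ∣j∣ ⟧                            ≈⟨ ⟦◃⟧ s (∣i∣ ℕ.* ∣j∣) ⟩
    signed s ((∣i∣ ℕ.* ∣j∣) ×ᵤ 1#)                    ≈⟨ signed-cong s (×1-homo-* ∣i∣ ∣j∣) ⟩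
    signed s ((∣i∣ ×ᵤ 1#) * (∣j∣ ×ᵤ 1#))               ≈⟨ signed-* (ℤ.sign i) (ℤ.sign j) _ _ ⟩
    signed (ℤ.sign i) (∣i∣ ×ᵤ 1#) * signed (ℤ.sign j) (∣j∣ ×ᵤ 1#) ≈⟨ *-cong (⟦⟧-signAbs i) (⟦⟧-signAbs j) ⟨
    ⟦ i ⟧ * ⟦ j ⟧                                    ∎
    where
    s = ℤ.sign i Sign.* ℤ.sign j
    ∣i∣ = ℤ.∣ i ∣
    ∣j∣ = ℤ.∣ j ∣

  ℤ-rawRing : RawRing _ _
  ℤ-rawRing = record
    { Carrier = ℤ ; _≈_ = _≡_ ; _+_ = ℤ._+_ ; _*_ = ℤ._*_ ; -_ = ℤ.-_ ; 0# = + 0 ; 1# = + 1 }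

  ℤ⟶𝓡 : ℤ-rawRing ACR.-Raw-AlmostCommutative⟶ ACR.fromCommutativeRing 𝓡
  ℤ⟶𝓡 = record
    { ⟦_⟧ = ⟦_⟧ ; +-homo = ⟦+⟧ ; *-homo = ⟦*⟧ ; -‿homo = ⟦-⟧ ; 0-homo = refl ; 1-homo = refl }

  ⟦⟧-weaklyDecidable : ∀ i j → Maybe (⟦ i ⟧ ≈ ⟦ j ⟧)
  ⟦⟧-weaklyDecidable i j with i ℤ.≟ j
  ... | yes ≡.refl = just refl
  ... | no _       = nothing

  open import Algebra.Solver.Ring ℤ-rawRing (ACR.fromCommutativeRing 𝓡) ℤ⟶𝓡 ⟦⟧-weaklyDecidable public
    using (solve; con; _:+_; _:*_; :-_; _:=_)

open import Algebra.Morphism.Bundles using (RingHomomorphism)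
open import Algebra.Morphism.Construct.Composition using (ringHomomorphism)

RingHom : ∀ {a ℓa b ℓb} → CommutativeRing a ℓa → CommutativeRing b ℓb → Set _
RingHom 𝓐 𝓑 = RingHomomorphism (CommutativeRing.rawRing 𝓐) (CommutativeRing.rawRing 𝓑)

module _ {a ℓa b ℓb} {𝓐 : CommutativeRing a ℓa} {𝓑 : CommutativeRing b ℓb} where
  private
    module A = CommutativeRing 𝓐
    module B = CommutativeRing 𝓑

  mkRingHomomorphism : (f : A.Carrier → B.Carrier) →
    (∀ {x y} → x A.≈ y → f x B.≈ f y) →
    (∀ x y → f (x A.+ y) B.≈ f x B.+ f y) →
    (∀ x y → f (x A.* y) B.≈ f x B.* f y) →
    (∀ x → f (A.- x) B.≈ B.- f x) →
    f A.0# B.≈ B.0# → f A.1# B.≈ B.1# →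
    RingHom 𝓐 𝓑
  mkRingHomomorphism f cong +-homo *-homo -‿homo 0#-homo 1#-homo = record
    { ⟦_⟧ = f
    ; isRingHomomorphism = record
      { isSemiringHomomorphism = record
        { isNearSemiringHomomorphism = record
          { +-isMonoidHomomorphism = record
            { isMagmaHomomorphism = record { isRelHomomorphism = record { cong = cong } ; homo = +-homo }
            ; ε-homo = 0#-homo }
          ; *-homo = *-homo }
        ; 1#-homo = 1#-homo }
      ; -‿homo = -‿homo } }

module InverseIdentities {c ℓ} (𝓡 : CommutativeRing c ℓ) where
  open CommutativeRing 𝓡
  open IntegerCoefficientSolver 𝓡 using (solve; _:+_; _:*_; :-_; _:=_)
  open import Algebra.Properties.Ring ring using (-‿distribˡ-*)
  open import Relation.Binary.Reasoning.Setoid setoid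

  ar≈1⇒φ-pr+krr≈[aaφ-ap+k]rr : ∀ a r φ p k → a * r ≈ 1# →
    (φ - p * r) + k * (r * r) ≈ ((a * (a * φ) + a * (- p)) + k) * (r * r)
  ar≈1⇒φ-pr+krr≈[aaφ-ap+k]rr a r φ p k ar≈1 = sym (begin
    ((a * (a * φ) + a * (- p)) + k) * (r * r)
      ≈⟨ solve 5 (λ a r φ p k → ((a :* (a :* φ) :+ a :* (:- p)) :+ k) :* (r :* r)
                             := φ :* ((a :* r) :* (a :* r)) :+ (:- p) :* (r :* (a :* r)) :+ k :* (r :* r))
                 refl a r φ p k ⟩
    φ * ((a * r) * (a * r)) + (- p) * (r * (a * r)) + k * (r * r)
      ≈⟨ +-congʳ (+-cong (*-congˡ (*-cong ar≈1 ar≈1)) (*-congˡ (*-congˡ ar≈1))) ⟩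
    φ * (1# * 1#) + (- p) * (r * 1#) + k * (r * r)
      ≈⟨ +-congʳ (+-cong (trans (*-congˡ (*-identityˡ 1#)) (*-identityʳ φ))
                         (trans (*-congˡ (*-identityʳ r)) (sym (-‿distribˡ-* p r)))) ⟩
    (φ - p * r) + k * (r * r) ∎)

  ar≈1⇒[a-u][[a-v]t]rr≈[1-ur][1-vr]t : ∀ a r u v t → a * r ≈ 1# →
    ((a - u) * ((a - v) * t)) * (r * r) ≈ ((1# - u * r) * (1# - v * r)) * t
  ar≈1⇒[a-u][[a-v]t]rr≈[1-ur][1-vr]t a r u v t ar≈1 = begin
    ((a - u) * ((a - v) * t)) * (r * r)
      ≈⟨ solve 5 (λ a r u v t → ((a :+ :- u) :* ((a :+ :- v) :* t)) :* (r :* r)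
                             := ((a :* r) :+ :- (u :* r)) :* ((a :* r) :+ :- (v :* r)) :* t)
                 refl a r u v t ⟩
    ((a * r - u * r) * (a * r - v * r)) * t
      ≈⟨ *-congʳ (*-cong (+-congʳ ar≈1) (+-congʳ ar≈1)) ⟩
    ((1# - u * r) * (1# - v * r)) * t ∎

open import Defs using (module Series)

module PowerSeriesRing {c ℓ} (𝓡 : CommutativeRing c ℓ) where
  open CommutativeRing 𝓡
  open Series 𝓡
  open IntegerCoefficientSolver 𝓡 using (solve; con; _:+_; _:*_; _:=_)
  open import Algebra.Properties.Ring ring using (-0#≈0#)
  open import Algebra.Properties.CommutativeSemigroup +-commutativeSemigroup using (interchange)
  open import Relation.Binary.Reasoning.Setoid setoid

  Σ<-cong : ∀ n {f g : ℕ → Carrier} → (∀ k → k < n → f k ≈ g k) → Σ< n f ≈ Σ< n g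
  Σ<-cong zero    e = refl
  Σ<-cong (suc n) e = +-cong (Σ<-cong n (λ k k<n → e k (ℕ.m<n⇒m<1+n k<n))) (e n ℕ.≤-refl)

  Σ<-congᵖ : ∀ n {f g : ℕ → Carrier} → (∀ k → f k ≈ g k) → Σ< n f ≈ Σ< n g
  Σ<-congᵖ n e = Σ<-cong n (λ k _ → e k)

  Σ<-zero : ∀ n {f : ℕ → Carrier} → (∀ k → k < n → f k ≈ 0#) → Σ< n f ≈ 0#
  Σ<-zero zero    e = refl
  Σ<-zero (suc n) e =
    trans (+-cong (Σ<-zero n (λ k k<n → e k (ℕ.m<n⇒m<1+n k<n))) (e n ℕ.≤-refl)) (+-identityʳ 0#)

  Σ<-+ : ∀ n (f g : ℕ → Carrier) → Σ< n (λ k → f k + g k) ≈ Σ< n f + Σ< n g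
  Σ<-+ zero    f g = sym (+-identityˡ 0#)
  Σ<-+ (suc n) f g = trans (+-congʳ (Σ<-+ n f g)) (interchange _ _ _ _)

  *-distribˡ-Σ< : ∀ n a (f : ℕ → Carrier) → a * Σ< n f ≈ Σ< n (λ k → a * f k)
  *-distribˡ-Σ< zero    a f = zeroʳ a
  *-distribˡ-Σ< (suc n) a f = trans (distribˡ _ _ _) (+-congʳ (*-distribˡ-Σ< n a f))

  Σ<-suc : ∀ n (f : ℕ → Carrier) → Σ< (suc n) f ≈ f 0 + Σ< n (λ k → f (suc k))
  Σ<-suc zero    f = trans (+-identityˡ _) (sym (+-identityʳ _))
  Σ<-suc (suc n) f = trans (+-congʳ (Σ<-suc n f)) (+-assoc _ _ _)

  Σ<-reverse : ∀ n (f : ℕ → Carrier) → Σ< n f ≈ Σ< n (λ k → f (n ∸ suc k))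
  Σ<-reverse zero    f = refl
  Σ<-reverse (suc n) f = begin
    Σ< n f + f n                              ≈⟨ +-congʳ (Σ<-reverse n f) ⟩
    Σ< n (λ k → f (n ∸ suc k)) + f n          ≈⟨ +-comm _ _ ⟩
    f n + Σ< n (λ k → f (n ∸ suc k))          ≈⟨ Σ<-suc n (λ k → f (suc n ∸ suc k)) ⟨
    Σ< (suc n) (λ k → f (suc n ∸ suc k))      ∎

  Σ<-swap : ∀ m n (F : ℕ → ℕ → Carrier) →
            Σ< m (λ a → Σ< n (F a)) ≈ Σ< n (λ b → Σ< m (λ a → F a b))
  Σ<-swap zero    n F = sym (Σ<-zero n (λ _ _ → refl))
  Σ<-swap (suc m) n F = trans (+-congʳ (Σ<-swap m n F)) (sym (Σ<-+ n _ _))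

  tailₚ : PS → PS
  tailₚ f k = f (suc k)

  _·ₚ_ : Carrier → PS → PS
  (a ·ₚ f) k = a * f k

  *ₚ-suc : ∀ n (f g : PS) → (f *ₚ g) (suc n) ≈ f 0 * g (suc n) + (tailₚ f *ₚ g) n
  *ₚ-suc n f g = Σ<-suc (suc n) (λ k → f k * g (suc n ∸ k))

  *ₚ-congˡ : ∀ {f f′} g → f ≈ₚ f′ → (f *ₚ g) ≈ₚ (f′ *ₚ g)
  *ₚ-congˡ g e n = Σ<-congᵖ (suc n) (λ k → *-congʳ (e k))

  *ₚ-congʳ : ∀ f {g g′} → g ≈ₚ g′ → (f *ₚ g) ≈ₚ (f *ₚ g′)
  *ₚ-congʳ f e n = Σ<-congᵖ (suc n) (λ k → *-congˡ (e (n ∸ k)))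

  *ₚ-cong : ∀ {f f′ g g′} → f ≈ₚ f′ → g ≈ₚ g′ → (f *ₚ g) ≈ₚ (f′ *ₚ g′)
  *ₚ-cong {f′ = f′} {g} e e′ n = trans (*ₚ-congˡ g e n) (*ₚ-congʳ f′ e′ n)

  *ₚ-congʳ-≤ : ∀ f {g g′} n → (∀ m → m ≤ n → g m ≈ g′ m) → (f *ₚ g) n ≈ (f *ₚ g′) n
  *ₚ-congʳ-≤ f n e = Σ<-congᵖ (suc n) (λ k → *-congˡ (e (n ∸ k) (ℕ.m∸n≤m n k)))

  *ₚ-comm : ∀ f g → (f *ₚ g) ≈ₚ (g *ₚ f)
  *ₚ-comm f g n = begin
    Σ< (suc n) (λ k → f k * g (n ∸ k))              ≈⟨ Σ<-reverse (suc n) _ ⟩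
    Σ< (suc n) (λ k → f (n ∸ k) * g (n ∸ (n ∸ k)))  ≈⟨ Σ<-cong (suc n) swap ⟩
    Σ< (suc n) (λ k → g k * f (n ∸ k))              ∎
    where
    swap : ∀ k → k < suc n → f (n ∸ k) * g (n ∸ (n ∸ k)) ≈ g k * f (n ∸ k)
    swap k k≤n = trans (*-comm _ _) (*-congʳ (reflexive (≡.cong g (ℕ.m∸[m∸n]≡n (ℕ.≤-pred k≤n)))))

  *ₚ-distribʳ : ∀ f g h → ((f +ₚ g) *ₚ h) ≈ₚ ((f *ₚ h) +ₚ (g *ₚ h))
  *ₚ-distribʳ f g h n = trans (Σ<-congᵖ (suc n) (λ k → distribʳ _ _ _)) (Σ<-+ (suc n) _ _)

  *ₚ-distribˡ : ∀ f g h → (f *ₚ (g +ₚ h)) ≈ₚ ((f *ₚ g) +ₚ (f *ₚ h))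
  *ₚ-distribˡ f g h n = trans (Σ<-congᵖ (suc n) (λ k → distribˡ _ _ _)) (Σ<-+ (suc n) _ _)

  ·ₚ-*ₚ : ∀ a f g → (a ·ₚ f) *ₚ g ≈ₚ a ·ₚ (f *ₚ g)
  ·ₚ-*ₚ a f g n = trans (Σ<-congᵖ (suc n) (λ k → *-assoc _ _ _)) (sym (*-distribˡ-Σ< (suc n) a _))

  tailₚ-*ₚ : ∀ f g → tailₚ (f *ₚ g) ≈ₚ (f 0 ·ₚ tailₚ g) +ₚ (tailₚ f *ₚ g)
  tailₚ-*ₚ f g n = *ₚ-suc n f g

  *ₚ-assoc : ∀ f g h → ((f *ₚ g) *ₚ h) ≈ₚ (f *ₚ (g *ₚ h))
  *ₚ-assoc f g h zero =
    solve 3 (λ a b c → con (+ 0) :+ (con (+ 0) :+ a :* b) :* c := con (+ 0) :+ a :* (con (+ 0) :+ b :* c))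
      refl (f 0) (g 0) (h 0)
  *ₚ-assoc f g h (suc n) = begin
    ((f *ₚ g) *ₚ h) (suc n)
      ≈⟨ *ₚ-suc n (f *ₚ g) h ⟩
    (f *ₚ g) 0 * h (suc n) + (tailₚ (f *ₚ g) *ₚ h) n
      ≈⟨ +-congˡ (*ₚ-congˡ h (tailₚ-*ₚ f g) n) ⟩
    (f *ₚ g) 0 * h (suc n) + (((f 0 ·ₚ tailₚ g) +ₚ (tailₚ f *ₚ g)) *ₚ h) n
      ≈⟨ +-congˡ (*ₚ-distribʳ _ _ h n) ⟩
    (f *ₚ g) 0 * h (suc n) + (((f 0 ·ₚ tailₚ g) *ₚ h) n + ((tailₚ f *ₚ g) *ₚ h) n)
      ≈⟨ +-congˡ (+-cong (·ₚ-*ₚ (f 0) (tailₚ g) h n) (*ₚ-assoc (tailₚ f) g h n)) ⟩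
    (0# + f 0 * g 0) * h (suc n) + (f 0 * (tailₚ g *ₚ h) n + (tailₚ f *ₚ (g *ₚ h)) n)
      ≈⟨ regroup (f 0) (g 0) (h (suc n)) _ _ ⟩
    f 0 * (g 0 * h (suc n) + (tailₚ g *ₚ h) n) + (tailₚ f *ₚ (g *ₚ h)) n
      ≈⟨ +-congʳ (*-congˡ (*ₚ-suc n g h)) ⟨
    f 0 * (g *ₚ h) (suc n) + (tailₚ f *ₚ (g *ₚ h)) n
      ≈⟨ *ₚ-suc n f (g *ₚ h) ⟨
    (f *ₚ (g *ₚ h)) (suc n) ∎
    where
    regroup : ∀ a b c d e → (0# + a * b) * c + (a * d + e) ≈ a * (b * c + d) + e
    regroup = solve 5 (λ a b c d e → (con (+ 0) :+ a :* b) :* c :+ (a :* d :+ e) := a :* (b :* c :+ d) :+ e) refl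

  constₚ-0# : ∀ n → constₚ 0# n ≈ 0#
  constₚ-0# zero    = refl
  constₚ-0# (suc n) = refl

  *ₚ-zeroˡ : ∀ {z} f → (∀ k → z k ≈ 0#) → ∀ n → (z *ₚ f) n ≈ 0#
  *ₚ-zeroˡ f z≈0 n = Σ<-zero (suc n) (λ k _ → trans (*-congʳ (z≈0 k)) (zeroˡ _))

  constₚ-*ₚ : ∀ a f n → (constₚ a *ₚ f) n ≈ a * f n
  constₚ-*ₚ a f zero    = +-identityˡ _
  constₚ-*ₚ a f (suc n) =
    trans (*ₚ-suc n (constₚ a) f) (trans (+-congˡ (*ₚ-zeroˡ f (λ _ → refl) n)) (+-identityʳ _))

  *ₚ-identityˡ : ∀ f → (constₚ 1# *ₚ f) ≈ₚ f
  *ₚ-identityˡ f n = trans (constₚ-*ₚ 1# f n) (*-identityˡ _)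

  isCommutativeRingₚ : IsCommutativeRing _≈ₚ_ _+ₚ_ _*ₚ_ -ₚ_ (constₚ 0#) (constₚ 1#)
  isCommutativeRingₚ = record
    { isRing = record
      { +-isAbelianGroup = record
        { isGroup = record
          { isMonoid = record
            { isSemigroup = record
              { isMagma = record
                { isEquivalence = record
                  { refl = λ n → refl ; sym = λ e n → sym (e n) ; trans = λ e e′ n → trans (e n) (e′ n) }
                ; ∙-cong = λ e e′ n → +-cong (e n) (e′ n) }
              ; assoc = λ f g h n → +-assoc _ _ _ }
            ; identity = (λ f n → trans (+-congʳ (constₚ-0# n)) (+-identityˡ _))
                       , (λ f n → trans (+-congˡ (constₚ-0# n)) (+-identityʳ _)) }
          ; inverse = (λ f n → trans (-‿inverseˡ _) (sym (constₚ-0# n)))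
                    , (λ f n → trans (-‿inverseʳ _) (sym (constₚ-0# n)))
          ; ⁻¹-cong = λ e n → -‿cong (e n) }
        ; comm = λ f g n → +-comm _ _ }
      ; *-cong = *ₚ-cong
      ; *-assoc = *ₚ-assoc
      ; *-identity = *ₚ-identityˡ , (λ f n → trans (*ₚ-comm f (constₚ 1#) n) (*ₚ-identityˡ f n))
      ; distrib = *ₚ-distribˡ , (λ h f g → *ₚ-distribʳ f g h) }
    ; *-comm = *ₚ-comm }

  commutativeRingₚ : CommutativeRing c ℓ
  commutativeRingₚ = record { isCommutativeRing = isCommutativeRingₚ }

  varₚ-*ₚ-zero : ∀ f → (varₚ *ₚ f) 0 ≈ 0#
  varₚ-*ₚ-zero f = trans (+-identityˡ _) (zeroˡ _)

  varₚ-*ₚ-suc : ∀ f n → (varₚ *ₚ f) (suc n) ≈ f n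
  varₚ-*ₚ-suc f n = begin
    (varₚ *ₚ f) (suc n)                ≈⟨ *ₚ-suc n varₚ f ⟩
    0# * f (suc n) + (tailₚ varₚ *ₚ f) n ≈⟨ +-cong (zeroˡ _) (*ₚ-congˡ f tail-varₚ n) ⟩
    0# + (constₚ 1# *ₚ f) n            ≈⟨ +-identityˡ _ ⟩
    (constₚ 1# *ₚ f) n                 ≈⟨ *ₚ-identityˡ f n ⟩
    f n                                ∎
    where
    tail-varₚ : tailₚ varₚ ≈ₚ constₚ 1#
    tail-varₚ zero    = refl
    tail-varₚ (suc n) = refl

  constₚ+varₚ*tailₚ : ∀ f → f ≈ₚ constₚ (f 0) +ₚ (varₚ *ₚ tailₚ f)
  constₚ+varₚ*tailₚ f zero    = sym (trans (+-congˡ (varₚ-*ₚ-zero (tailₚ f))) (+-identityʳ _))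
  constₚ+varₚ*tailₚ f (suc n) = sym (trans (+-congˡ (varₚ-*ₚ-suc (tailₚ f) n)) (+-identityˡ _))

  *ₚ-cancel-order-one : ∀ d e v → d 0 ≈ 0# → v * d 1 ≈ 1# → (d *ₚ e) ≈ₚ constₚ 0# → e ≈ₚ constₚ 0#
  *ₚ-cancel-order-one d e v d₀≈0 v*d₁≈1 de≈0 = <-rec _ step
    where
    open import Data.Nat.Induction using (<-rec)
    step : ∀ n → (∀ {m} → m < n → e m ≈ constₚ 0# m) → e n ≈ constₚ 0# n
    step n below = begin
      e n                 ≈⟨ *-identityˡ _ ⟨
      1# * e n            ≈⟨ *-congʳ v*d₁≈1 ⟨
      (v * d 1) * e n     ≈⟨ *-assoc _ _ _ ⟩
      v * (d 1 * e n)     ≈⟨ *-congˡ d₁eₙ≈0 ⟩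
      v * 0#              ≈⟨ zeroʳ v ⟩
      0#                  ≈⟨ constₚ-0# n ⟨
      constₚ 0# n         ∎
      where
      higher : Σ< n (λ k → d (suc (suc k)) * e (n ∸ suc k)) ≈ 0#
      higher = Σ<-zero n (λ k k<n →
        trans (*-congˡ (trans (below (ℕ.∸-monoʳ-< {o = 0} (s≤s z≤n) k<n)) (constₚ-0# (n ∸ suc k))))
              (zeroʳ _))
      d₁eₙ≈0 : d 1 * e n ≈ 0#
      d₁eₙ≈0 = begin
        d 1 * e n                                                     ≈⟨ +-identityʳ _ ⟨
        d 1 * e n + 0#                                                ≈⟨ +-congˡ higher ⟨
        d 1 * e n + Σ< n (λ k → d (suc (suc k)) * e (n ∸ suc k))      ≈⟨ Σ<-suc n _ ⟨
        (tailₚ d *ₚ e) n                                              ≈⟨ +-identityˡ _ ⟨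
        0# + (tailₚ d *ₚ e) n                                         ≈⟨ +-congʳ (trans (*-congʳ d₀≈0) (zeroˡ _)) ⟨
        d 0 * e (suc n) + (tailₚ d *ₚ e) n                            ≈⟨ *ₚ-suc n d e ⟨
        (d *ₚ e) (suc n)                                              ≈⟨ de≈0 (suc n) ⟩
        0#                                                            ∎

  constₚ-cong : ∀ {x y} → x ≈ y → constₚ x ≈ₚ constₚ y
  constₚ-cong e zero    = e
  constₚ-cong e (suc n) = refl

  constₚ-homomorphism : RingHom 𝓡 commutativeRingₚ
  constₚ-homomorphism = mkRingHomomorphism {𝓐 = 𝓡} {𝓑 = commutativeRingₚ} constₚ constₚ-cong
    constₚ-+ (λ x y n → sym (trans (constₚ-*ₚ x (constₚ y) n) (·-constₚ x y n))) constₚ-neg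
    (λ n → refl) (λ n → refl)
    where
    constₚ-+ : ∀ x y → constₚ (x + y) ≈ₚ constₚ x +ₚ constₚ y
    constₚ-+ x y zero    = refl
    constₚ-+ x y (suc n) = sym (+-identityʳ 0#)
    constₚ-neg : ∀ x → constₚ (- x) ≈ₚ -ₚ constₚ x
    constₚ-neg x zero    = refl
    constₚ-neg x (suc n) = sym -0#≈0#
    ·-constₚ : ∀ x y n → x * constₚ y n ≈ constₚ (x * y) n
    ·-constₚ x y zero    = refl
    ·-constₚ x y (suc n) = zeroʳ x

  private module Series² = Series commutativeRingₚ

  Σ<ₚ-at : ∀ n (F : ℕ → PS) j → Series².Σ< n F j ≈ Σ< n (λ a → F a j)
  Σ<ₚ-at zero    F j = constₚ-0# j
  Σ<ₚ-at (suc n) F j = +-congʳ (Σ<ₚ-at n F j)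

module CoefficientMap {a ℓa b ℓb} {𝓐 : CommutativeRing a ℓa} {𝓑 : CommutativeRing b ℓb}
                      (h : RingHom 𝓐 𝓑) where
  private
    module A = CommutativeRing 𝓐
    module B = CommutativeRing 𝓑
    module SA = Series 𝓐
    module SB = Series 𝓑
    module PA = PowerSeriesRing 𝓐
    module PB = PowerSeriesRing 𝓑
  open RingHomomorphism h

  ⟦⟧-Σ< : ∀ n f → ⟦ SA.Σ< n f ⟧ B.≈ SB.Σ< n (λ k → ⟦ f k ⟧)
  ⟦⟧-Σ< zero    f = 0#-homo
  ⟦⟧-Σ< (suc n) f = B.trans (+-homo _ _) (B.+-congʳ (⟦⟧-Σ< n f))

  ⟦⟧-constₚ : ∀ x → (λ n → ⟦ SA.constₚ x n ⟧) SB.≈ₚ SB.constₚ ⟦ x ⟧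
  ⟦⟧-constₚ x zero    = B.refl
  ⟦⟧-constₚ x (suc n) = 0#-homo

  mapₚ : RingHom PA.commutativeRingₚ PB.commutativeRingₚ
  mapₚ = mkRingHomomorphism {𝓐 = PA.commutativeRingₚ} {𝓑 = PB.commutativeRingₚ}
    (λ f n → ⟦ f n ⟧) (λ e n → ⟦⟧-cong (e n)) (λ f g n → +-homo _ _)
    (λ f g n → B.trans (⟦⟧-Σ< (suc n) _) (PB.Σ<-congᵖ (suc n) (λ k → *-homo _ _)))
    (λ f n → -‿homo _)
    (λ n → B.trans (⟦⟧-constₚ A.0# n) (PB.constₚ-cong 0#-homo n))
    (λ n → B.trans (⟦⟧-constₚ A.1# n) (PB.constₚ-cong 1#-homo n))

  private module Mapₚ = RingHomomorphism mapₚ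

  mapₚ-^ₚ : ∀ F k → Mapₚ.⟦ F SA.^ₚ k ⟧ SB.≈ₚ (Mapₚ.⟦ F ⟧ SB.^ₚ k)
  mapₚ-^ₚ F zero    = Mapₚ.1#-homo
  mapₚ-^ₚ F (suc k) n = B.trans (Mapₚ.*-homo F (F SA.^ₚ k) n) (PB.*ₚ-congʳ Mapₚ.⟦ F ⟧ (mapₚ-^ₚ F k) n)

  mapₚ-compₚ : ∀ a F → Mapₚ.⟦ SA.compₚ a F ⟧ SB.≈ₚ SB.compₚ Mapₚ.⟦ a ⟧ Mapₚ.⟦ F ⟧
  mapₚ-compₚ a F n = B.trans (⟦⟧-Σ< (suc n) _)
    (PB.Σ<-congᵖ (suc n) (λ k → B.trans (*-homo _ _) (B.*-congˡ (mapₚ-^ₚ F k n))))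

module BivariatePowerSeries {c ℓ} (𝓡 : CommutativeRing c ℓ) where
  open CommutativeRing 𝓡
  open Series 𝓡
  open PowerSeriesRing 𝓡
  -- R[[y]][[X]]: an element G : ℕ → PS lists its coefficients of Xⁱ, each a series in y.
  module 𝔻 = Series commutativeRingₚ
  module P𝔻 = PowerSeriesRing commutativeRingₚ

  X-_ : PS → (ℕ → PS)
  X- W = 𝔻.varₚ 𝔻.+ₚ 𝔻.constₚ (-ₚ W)

  transpose : (ℕ → PS) → (ℕ → PS)
  transpose D j i = D i j

  transpose-homomorphism : RingHom P𝔻.commutativeRingₚ P𝔻.commutativeRingₚ
  transpose-homomorphism = mkRingHomomorphism {𝓐 = P𝔻.commutativeRingₚ} {𝓑 = P𝔻.commutativeRingₚ}
    transpose (λ e j i → e i j) (λ D E j i → refl) transpose-*ₚ (λ D j i → refl)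
    (transpose-constₚ 0#) (transpose-constₚ 1#)
    where
    transpose-constₚ : ∀ x j i → 𝔻.constₚ (constₚ x) i j ≈ 𝔻.constₚ (constₚ x) j i
    transpose-constₚ x zero    zero    = refl
    transpose-constₚ x zero    (suc i) = refl
    transpose-constₚ x (suc j) zero    = refl
    transpose-constₚ x (suc j) (suc i) = refl
    transpose-*ₚ : ∀ D E j i → (D 𝔻.*ₚ E) i j ≈ (transpose D 𝔻.*ₚ transpose E) j i
    transpose-*ₚ D E j i = begin
      (D 𝔻.*ₚ E) i j                                              ≈⟨ Σ<ₚ-at (suc i) _ j ⟩
      Σ< (suc i) (λ a → Σ< (suc j) (λ b → D a b * E (i ∸ a) (j ∸ b))) ≈⟨ Σ<-swap (suc i) (suc j) _ ⟩
      Σ< (suc j) (λ b → Σ< (suc i) (λ a → D a b * E (i ∸ a) (j ∸ b))) ≈⟨ Σ<ₚ-at (suc j) _ i ⟨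
      (transpose D 𝔻.*ₚ transpose E) j i                          ∎
      where
      open import Relation.Binary.Reasoning.Setoid setoid

module LaurentSeriesRing {c ℓ} (𝓡 : CommutativeRing c ℓ) where
  open CommutativeRing 𝓡
  open Series 𝓡
  open PowerSeriesRing 𝓡
  open import Algebra.Properties.Ring ring using (-0#≈0#)
  open import Algebra.Properties.Group (AbelianGroup.group ℤ.+-0-abelianGroup)
    using (x≈z//y; //-rightDividesˡ)

  laurent : ℕ → PS → Laurent
  laurent o f = record { ord = o ; cf = f }

  ≈L-refl : ∀ {A} → A ≈L A
  ≈L-refl i = refl

  ≈L-sym : ∀ {A B} → A ≈L B → B ≈L A
  ≈L-sym e i = sym (e i)

  ≈L-trans : ∀ {A B C} → A ≈L B → B ≈L C → A ≈L C
  ≈L-trans e e′ i = trans (e i) (e′ i)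

  ≈L-setoid : Setoid c ℓ
  ≈L-setoid = record
    { Carrier = Laurent ; _≈_ = _≈L_
    ; isEquivalence = record { refl = ≈L-refl ; sym = ≈L-sym ; trans = ≈L-trans } }

  infix 4 _≋_
  _≋_ : Laurent → Laurent → Set ℓ
  A ≋ B = (ord A ≡ ord B) × (cf A ≈ₚ cf B)

  atℤ-cong : ∀ {f g} → f ≈ₚ g → ∀ j → atℤ f j ≈ atℤ g j
  atℤ-cong e (+ n)    = e n
  atℤ-cong e -[1+ n ] = refl

  ≋⇒≈L : ∀ {A B} → A ≋ B → A ≈L B
  ≋⇒≈L {A} {B} (≡.refl , e) i = atℤ-cong e (i ℤ.+ + ord B)

  ≈L⇒≋ : ∀ {A B} → ord A ≡ ord B → A ≈L B → A ≋ B
  ≈L⇒≋ {A} {B} o≡o′ e = o≡o′ , λ k → begin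
    cf A k                       ≡⟨ ≡.cong (atℤ (cf A)) (//-rightDividesˡ (+ ord A) (+ k)) ⟨
    coefL A (+ k ℤ.- + ord A)    ≈⟨ e (+ k ℤ.- + ord A) ⟩
    coefL B (+ k ℤ.- + ord A)    ≡⟨ ≡.cong (λ o → coefL B (+ k ℤ.- + o)) o≡o′ ⟩
    coefL B (+ k ℤ.- + ord B)    ≡⟨ ≡.cong (atℤ (cf B)) (//-rightDividesˡ (+ ord B) (+ k)) ⟩
    cf B k                       ∎
    where
    open import Relation.Binary.Reasoning.Setoid setoid

  coefL-mkL : ∀ N g → (∀ i m → i ℤ.+ + N ≡ -[1+ m ] → g i ≈ 0#) → ∀ i → coefL (mkL N g) i ≈ g i
  coefL-mkL N g g-below i = at (i ℤ.+ + N) ≡.refl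
    where
    at : ∀ j → i ℤ.+ + N ≡ j → atℤ (λ k → g (+ k ℤ.- + N)) j ≈ g i
    at (+ k)    eq = reflexive (≡.cong g (≡.sym (x≈z//y i (+ N) (+ k) eq)))
    at -[1+ m ] eq = sym (g-below i m eq)

  coefL-below : ∀ A b i m → i ℤ.+ + (ord A ℕ.+ b) ≡ -[1+ m ] → coefL A i ≈ 0#
  coefL-below A b i m eq = at (i ℤ.+ + ord A) ≡.refl
    where
    at : ∀ j → i ℤ.+ + ord A ≡ j → atℤ (cf A) j ≈ 0#
    at -[1+ n ] _ = refl
    at (+ k) eq′ with () ← ≡.trans (≡.sym eq)
      (≡.trans (≡.sym (ℤ.+-assoc i (+ ord A) (+ b))) (≡.cong (ℤ._+ + b) eq′))

  coefL-+L : ∀ A B i → coefL (A +L B) i ≈ coefL A i + coefL B i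
  coefL-+L A B = coefL-mkL (ord A ℕ.+ ord B) _ λ i m eq →
    trans (+-cong (coefL-below A (ord B) i m eq) (coefL-below B (ord A) i m (≡.trans (≡.cong (λ o → i ℤ.+ + o) (ℕ.+-comm (ord B) (ord A))) eq)))
          (+-identityʳ 0#)

  coefL--L : ∀ A i → coefL (-L A) i ≈ - coefL A i
  coefL--L A i = at (i ℤ.+ + ord A)
    where
    at : ∀ j → atℤ (λ k → - cf A k) j ≈ - atℤ (cf A) j
    at (+ n)    = refl
    at -[1+ n ] = sym -0#≈0#

  coefL-0L : ∀ i → coefL 0L i ≈ 0#
  coefL-0L i = at (i ℤ.+ + 0)
    where
    at : ∀ j → atℤ (constₚ 0#) j ≈ 0#
    at (+ n)    = constₚ-0# n
    at -[1+ n ] = refl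

  open import Relation.Binary.Reasoning.Setoid ≈L-setoid

  raise : Laurent → Laurent
  raise A = laurent (suc (ord A)) (varₚ *ₚ cf A)

  raise-≈L : ∀ A → raise A ≈L A
  raise-≈L A i = trans (reflexive (≡.cong (atℤ (varₚ *ₚ cf A)) index)) (at (i ℤ.+ + ord A))
    where
    index : i ℤ.+ + suc (ord A) ≡ ℤ.suc (i ℤ.+ + ord A)
    index = ≡.trans (ℤ.+-comm i _) (≡.trans (ℤ.suc-+ (ord A) i) (≡.cong ℤ.suc (ℤ.+-comm (+ ord A) i)))
    at : ∀ j → atℤ (varₚ *ₚ cf A) (ℤ.suc j) ≈ atℤ (cf A) j
    at (+ n)          = varₚ-*ₚ-suc (cf A) n
    at -[1+ zero ]    = varₚ-*ₚ-zero (cf A)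
    at -[1+ suc n ]   = refl

  raise^ : ℕ → Laurent → Laurent
  raise^ zero    A = A
  raise^ (suc d) A = raise (raise^ d A)

  raise^-≈L : ∀ d A → raise^ d A ≈L A
  raise^-≈L zero    A = ≈L-refl
  raise^-≈L (suc d) A = ≈L-trans (raise-≈L (raise^ d A)) (raise^-≈L d A)

  ord-raise^ : ∀ d A → ord (raise^ d A) ≡ d ℕ.+ ord A
  ord-raise^ zero    A = ≡.refl
  ord-raise^ (suc d) A = ≡.cong suc (ord-raise^ d A)

  *L-≋ : ∀ {A A′ B B′} → A ≋ A′ → B ≋ B′ → A *L B ≋ A′ *L B′
  *L-≋ (o≡o′ , e) (p≡p′ , e′) = ≡.cong₂ ℕ._+_ o≡o′ p≡p′ , *ₚ-cong e e′

  raise^-*L : ∀ d A B → raise^ d (A *L B) ≋ raise^ d A *L B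
  raise^-*L zero    A B = ≡.refl , λ n → refl
  raise^-*L (suc d) A B with raise^-*L d A B
  ... | o≡o′ , e = ≡.cong suc o≡o′
                 , λ n → trans (*ₚ-congʳ varₚ e n) (sym (*ₚ-assoc varₚ (cf (raise^ d A)) (cf B) n))

  *L-comm : ∀ A B → A *L B ≋ B *L A
  *L-comm A B = ℕ.+-comm (ord A) (ord B) , *ₚ-comm (cf A) (cf B)

  -- Raised to the common order ord A + ord A′, the representations of A and A′ become ≋.
  *L-congˡ : ∀ {A A′} B → A ≈L A′ → A *L B ≈L A′ *L B
  *L-congˡ {A} {A′} B e = begin
      A *L B                            ≈⟨ raise^-≈L (ord A′) (A *L B) ⟨
      raise^ (ord A′) (A *L B)          ≈⟨ ≋⇒≈L (raise^-*L (ord A′) A B) ⟩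
      raise^ (ord A′) A *L B            ≈⟨ ≋⇒≈L (*L-≋ {B = B} (≈L⇒≋ same-ord raised-≈L) (≡.refl , λ n → refl)) ⟩
      raise^ (ord A) A′ *L B            ≈⟨ ≋⇒≈L (raise^-*L (ord A) A′ B) ⟨
      raise^ (ord A) (A′ *L B)          ≈⟨ raise^-≈L (ord A) (A′ *L B) ⟩
      A′ *L B                           ∎
    where
    same-ord : ord (raise^ (ord A′) A) ≡ ord (raise^ (ord A) A′)
    same-ord = ≡.trans (ord-raise^ (ord A′) A) (≡.trans (ℕ.+-comm (ord A′) (ord A)) (≡.sym (ord-raise^ (ord A) A′)))
    raised-≈L : raise^ (ord A′) A ≈L raise^ (ord A) A′
    raised-≈L = ≈L-trans (raise^-≈L (ord A′) A) (≈L-trans e (≈L-sym (raise^-≈L (ord A) A′)))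

  *L-congʳ : ∀ A {B B′} → B ≈L B′ → A *L B ≈L A *L B′
  *L-congʳ A {B} {B′} e = begin
    A *L B     ≈⟨ ≋⇒≈L (*L-comm A B) ⟩
    B *L A     ≈⟨ *L-congˡ A e ⟩
    B′ *L A    ≈⟨ ≋⇒≈L (*L-comm B′ A) ⟩
    A *L B′    ∎

  *L-cong : ∀ {A A′ B B′} → A ≈L A′ → B ≈L B′ → A *L B ≈L A′ *L B′
  *L-cong {A′ = A′} {B} e e′ = ≈L-trans (*L-congˡ B e) (*L-congʳ A′ e′)

  +L-cong : ∀ {A A′ B B′} → A ≈L A′ → B ≈L B′ → A +L B ≈L A′ +L B′
  +L-cong {A} {A′} {B} {B′} e e′ i =
    trans (coefL-+L A B i) (trans (+-cong (e i) (e′ i)) (sym (coefL-+L A′ B′ i)))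

  -L-cong : ∀ {A A′} → A ≈L A′ → -L A ≈L -L A′
  -L-cong {A} {A′} e i = trans (coefL--L A i) (trans (-‿cong (e i)) (sym (coefL--L A′ i)))

  +L-laurent : ∀ o f g → laurent o f +L laurent o g ≈L laurent o (f +ₚ g)
  +L-laurent o f g i = trans (coefL-+L (laurent o f) (laurent o g) i) (sym (at (i ℤ.+ + o)))
    where
    at : ∀ j → atℤ (f +ₚ g) j ≈ atℤ f j + atℤ g j
    at (+ n)    = refl
    at -[1+ n ] = sym (+-identityʳ 0#)

  raise^-to : ∀ d A {o} → d ℕ.+ ord A ≡ o → A ≈L laurent o (cf (raise^ d A))
  raise^-to d A eq = ≈L-trans (≈L-sym (raise^-≈L d A)) (≋⇒≈L (≡.trans (ord-raise^ d A) eq , λ n → refl))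

  *L-distribˡ : ∀ A B C → A *L (B +L C) ≈L A *L B +L A *L C
  *L-distribˡ A B C = begin
    A *L (B +L C)                                     ≈⟨ *L-congʳ A (+L-cong B≈ C≈) ⟩
    A *L (laurent o f +L laurent o g)                 ≈⟨ *L-congʳ A (+L-laurent o f g) ⟩
    laurent (ord A ℕ.+ o) (cf A *ₚ (f +ₚ g))          ≈⟨ ≋⇒≈L (≡.refl , *ₚ-distribˡ (cf A) f g) ⟩
    laurent (ord A ℕ.+ o) ((cf A *ₚ f) +ₚ (cf A *ₚ g)) ≈⟨ +L-laurent (ord A ℕ.+ o) _ _ ⟨
    A *L laurent o f +L A *L laurent o g              ≈⟨ +L-cong (*L-congʳ A (≈L-sym B≈)) (*L-congʳ A (≈L-sym C≈)) ⟩
    A *L B +L A *L C                                  ∎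
    where
    o = ord B ℕ.+ ord C
    f = cf (raise^ (ord C) B)
    g = cf (raise^ (ord B) C)
    B≈ : B ≈L laurent o f
    B≈ = raise^-to (ord C) B (ℕ.+-comm (ord C) (ord B))
    C≈ : C ≈L laurent o g
    C≈ = raise^-to (ord B) C ≡.refl

  +L-assoc : ∀ A B C → (A +L B) +L C ≈L A +L (B +L C)
  +L-assoc A B C i = trans (coefL-+L (A +L B) C i) (trans (+-congʳ (coefL-+L A B i))
    (trans (+-assoc _ _ _) (sym (trans (coefL-+L A (B +L C) i) (+-congˡ (coefL-+L B C i))))))

  isCommutativeRingL : IsCommutativeRing _≈L_ _+L_ _*L_ -L_ 0L (scalarL 1#)
  isCommutativeRingL = record
    { isRing = record
      { +-isAbelianGroup = record
        { isGroup = record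
          { isMonoid = record
            { isSemigroup = record
              { isMagma = record
                { isEquivalence = Setoid.isEquivalence ≈L-setoid
                ; ∙-cong = +L-cong }
              ; assoc = +L-assoc }
            ; identity = (λ A i → trans (coefL-+L 0L A i) (trans (+-congʳ (coefL-0L i)) (+-identityˡ _)))
                       , (λ A i → trans (coefL-+L A 0L i) (trans (+-congˡ (coefL-0L i)) (+-identityʳ _))) }
          ; inverse = (λ A i → trans (coefL-+L (-L A) A i)
                                 (trans (+-congʳ (coefL--L A i)) (trans (-‿inverseˡ _) (sym (coefL-0L i)))))
                    , (λ A i → trans (coefL-+L A (-L A) i)
                                 (trans (+-congˡ (coefL--L A i)) (trans (-‿inverseʳ _) (sym (coefL-0L i)))))
          ; ⁻¹-cong = -L-cong }
        ; comm = λ A B i → trans (coefL-+L A B i) (trans (+-comm _ _) (sym (coefL-+L B A i))) }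
      ; *-cong = *L-cong
      ; *-assoc = λ A B C → ≋⇒≈L (ℕ.+-assoc (ord A) (ord B) (ord C) , *ₚ-assoc (cf A) (cf B) (cf C))
      ; *-identity = *L-identityˡ , (λ A → ≈L-trans (≋⇒≈L (*L-comm A (scalarL 1#))) (*L-identityˡ A))
      ; distrib = *L-distribˡ , *L-distribʳ }
    ; *-comm = λ A B → ≋⇒≈L (*L-comm A B) }
    where
    *L-identityˡ : ∀ A → scalarL 1# *L A ≈L A
    *L-identityˡ A = ≋⇒≈L (≡.refl , *ₚ-identityˡ (cf A))
    *L-distribʳ : ∀ A B C → (B +L C) *L A ≈L B *L A +L C *L A
    *L-distribʳ A B C = begin
      (B +L C) *L A         ≈⟨ ≋⇒≈L (*L-comm (B +L C) A) ⟩
      A *L (B +L C)         ≈⟨ *L-distribˡ A B C ⟩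
      A *L B +L A *L C      ≈⟨ +L-cong (≋⇒≈L (*L-comm A B)) (≋⇒≈L (*L-comm A C)) ⟩
      B *L A +L C *L A      ∎

  commutativeRingL : CommutativeRing c ℓ
  commutativeRingL = record { isCommutativeRing = isCommutativeRingL }

  fromPS-homomorphism : RingHom commutativeRingₚ commutativeRingL
  fromPS-homomorphism = mkRingHomomorphism {𝓐 = commutativeRingₚ} {𝓑 = commutativeRingL}
    fromPS (λ e → ≋⇒≈L (≡.refl , e)) (λ f g → ≈L-sym (+L-laurent 0 f g))
    (λ f g i → refl) (λ f i → refl) (λ i → refl) (λ i → refl)

  fromPS-varₚ-*L-Xinv : fromPS varₚ *L Xinv ≈L scalarL 1#
  fromPS-varₚ-*L-Xinv = raise-≈L (scalarL 1#)

HasNoConstantTerm : ∀ {c ℓ} (𝓡 : CommutativeRing c ℓ) → Series.PS 𝓡 → Set ℓ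
HasNoConstantTerm 𝓡 Z = CommutativeRing._≈_ 𝓡 (Z 0) (CommutativeRing.0# 𝓡)

module Substitution {c ℓ} (𝓡 : CommutativeRing c ℓ) (Z : Series.PS 𝓡) (Z₀≈0 : HasNoConstantTerm 𝓡 Z) where
  open CommutativeRing 𝓡
  open Series 𝓡
  open PowerSeriesRing 𝓡
  open BivariatePowerSeries 𝓡 using (module 𝔻; module P𝔻; X-_)
  open import Relation.Binary.Reasoning.Setoid setoid

  Z^ : ℕ → PS
  Z^ k = Z ^ₚ k

  Z^-below : ∀ k m → m < k → Z^ k m ≈ 0#
  Z^-below (suc k) m m<k = Σ<-zero (suc m) term
    where
    term : ∀ t → t < suc m → Z t * Z^ k (m ∸ t) ≈ 0#
    term zero    _   = trans (*-congʳ Z₀≈0) (zeroˡ _)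
    term (suc t) t<m = trans (*-congˡ (Z^-below k (m ∸ suc t) m-t<k)) (zeroʳ _)
      where
      m-t<k : m ∸ suc t < k
      m-t<k = ℕ.<-≤-trans (ℕ.∸-monoʳ-< {o = 0} (s≤s z≤n) (ℕ.≤-pred t<m)) (ℕ.≤-pred m<k)

  *ₚ-Z^-below : ∀ f i n → n < i → (f *ₚ Z^ i) n ≈ 0#
  *ₚ-Z^-below f i n n<i = Σ<-zero (suc n) λ k _ →
    trans (*-congˡ (Z^-below i (n ∸ k) (ℕ.≤-<-trans (ℕ.m∸n≤m n k) n<i))) (zeroʳ _)

  -- Since Z has no constant term, only the terms i ≤ n of G(Z) = Σᵢ G i Zⁱ contribute to yⁿ.
  evalUpTo : ℕ → (ℕ → PS) → PS
  evalUpTo N G = 𝔻.Σ< N (λ i → G i *ₚ Z^ i)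

  eval : (ℕ → PS) → PS
  eval G n = evalUpTo (suc n) G n

  evalUpTo-at : ∀ N G n → evalUpTo N G n ≈ Σ< N (λ i → (G i *ₚ Z^ i) n)
  evalUpTo-at N G n = Σ<ₚ-at N _ n

  evalUpTo-stable : ∀ G n N → suc n ≤ N → evalUpTo N G n ≈ eval G n
  evalUpTo-stable G n N le =
    trans (reflexive (≡.cong (λ M → evalUpTo M G n) (≡.sym (ℕ.m∸n+n≡m le)))) (extra (N ∸ suc n))
    where
    extra : ∀ d → evalUpTo (d ℕ.+ suc n) G n ≈ eval G n
    extra zero    = refl
    extra (suc d) = trans (+-cong (extra d) (*ₚ-Z^-below (G _) (d ℕ.+ suc n) n (ℕ.m≤n+m (suc n) d)))
                          (+-identityʳ _)

  eval-cong : ∀ {G H} → G 𝔻.≈ₚ H → eval G ≈ₚ eval H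
  eval-cong {G} {H} e n = begin
    eval G n                              ≈⟨ evalUpTo-at (suc n) G n ⟩
    Σ< (suc n) (λ i → (G i *ₚ Z^ i) n)    ≈⟨ Σ<-congᵖ (suc n) (λ i → *ₚ-congˡ (Z^ i) (e i) n) ⟩
    Σ< (suc n) (λ i → (H i *ₚ Z^ i) n)    ≈⟨ evalUpTo-at (suc n) H n ⟨
    eval H n                              ∎

  eval-+ : ∀ G H → eval (G 𝔻.+ₚ H) ≈ₚ eval G +ₚ eval H
  eval-+ G H n = begin
    eval (G 𝔻.+ₚ H) n                                              ≈⟨ evalUpTo-at (suc n) _ n ⟩
    Σ< (suc n) (λ i → ((G i +ₚ H i) *ₚ Z^ i) n)                     ≈⟨ Σ<-congᵖ (suc n) (λ i → *ₚ-distribʳ (G i) (H i) (Z^ i) n) ⟩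
    Σ< (suc n) (λ i → (G i *ₚ Z^ i) n + (H i *ₚ Z^ i) n)            ≈⟨ Σ<-+ (suc n) _ _ ⟩
    Σ< (suc n) (λ i → (G i *ₚ Z^ i) n) + Σ< (suc n) (λ i → (H i *ₚ Z^ i) n)
                                                                   ≈⟨ +-cong (evalUpTo-at (suc n) G n) (evalUpTo-at (suc n) H n) ⟨
    eval G n + eval H n                                            ∎

  eval-constₚ : ∀ g → eval (𝔻.constₚ g) ≈ₚ g
  eval-constₚ g n = begin
    eval (𝔻.constₚ g) n                                                ≈⟨ evalUpTo-at (suc n) _ n ⟩
    Σ< (suc n) (λ i → (𝔻.constₚ g i *ₚ Z^ i) n)                         ≈⟨ Σ<-suc n _ ⟩
    (g *ₚ Z^ 0) n + Σ< n (λ i → (constₚ 0# *ₚ Z^ (suc i)) n)            ≈⟨ +-cong (*ₚ-identityʳ g n) (Σ<-zero n (λ i _ → *ₚ-zeroˡ (Z^ (suc i)) constₚ-0# n)) ⟩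
    g n + 0#                                                           ≈⟨ +-identityʳ _ ⟩
    g n                                                                ∎
    where
    *ₚ-identityʳ : ∀ f → (f *ₚ constₚ 1#) ≈ₚ f
    *ₚ-identityʳ f m = trans (*ₚ-comm f (constₚ 1#) m) (*ₚ-identityˡ f m)

  *ₚ-eval : ∀ a G n → (a *ₚ eval G) n ≈ Σ< (suc n) (λ i → (a *ₚ (G i *ₚ Z^ i)) n)
  *ₚ-eval a G n = begin
    (a *ₚ eval G) n                                ≈⟨ *ₚ-congʳ-≤ a n (λ m m≤n → evalUpTo-stable G m (suc n) (s≤s m≤n)) ⟨
    (a *ₚ evalUpTo (suc n) G) n                    ≈⟨ P𝔻.*-distribˡ-Σ< (suc n) a _ n ⟩
    𝔻.Σ< (suc n) (λ i → a *ₚ (G i *ₚ Z^ i)) n      ≈⟨ Σ<ₚ-at (suc n) _ n ⟩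
    Σ< (suc n) (λ i → (a *ₚ (G i *ₚ Z^ i)) n)      ∎

  eval-constₚ-*ₚ : ∀ a G → eval (𝔻.constₚ a 𝔻.*ₚ G) ≈ₚ a *ₚ eval G
  eval-constₚ-*ₚ a G n = begin
    eval (𝔻.constₚ a 𝔻.*ₚ G) n                             ≈⟨ evalUpTo-at (suc n) _ n ⟩
    Σ< (suc n) (λ i → ((𝔻.constₚ a 𝔻.*ₚ G) i *ₚ Z^ i) n)   ≈⟨ Σ<-congᵖ (suc n) reassoc ⟩
    Σ< (suc n) (λ i → (a *ₚ (G i *ₚ Z^ i)) n)              ≈⟨ *ₚ-eval a G n ⟨
    (a *ₚ eval G) n                                       ∎
    where
    reassoc : ∀ i → ((𝔻.constₚ a 𝔻.*ₚ G) i *ₚ Z^ i) n ≈ (a *ₚ (G i *ₚ Z^ i)) n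
    reassoc i = trans (*ₚ-congˡ (Z^ i) (P𝔻.constₚ-*ₚ a G i) n) (*ₚ-assoc a (G i) (Z^ i) n)

  eval-varₚ-*ₚ : ∀ G → eval (𝔻.varₚ 𝔻.*ₚ G) ≈ₚ Z *ₚ eval G
  eval-varₚ-*ₚ G n = begin
    eval XG n                                                     ≈⟨ evalUpTo-stable XG n (suc (suc n)) (ℕ.n≤1+n (suc n)) ⟨
    evalUpTo (suc (suc n)) XG n                                   ≈⟨ evalUpTo-at (suc (suc n)) XG n ⟩
    Σ< (suc (suc n)) (λ i → (XG i *ₚ Z^ i) n)                     ≈⟨ Σ<-suc (suc n) _ ⟩
    (XG 0 *ₚ Z^ 0) n + Σ< (suc n) (λ i → (XG (suc i) *ₚ Z^ (suc i)) n)
        ≈⟨ +-cong (*ₚ-zeroˡ (Z^ 0) (λ k → trans (P𝔻.varₚ-*ₚ-zero G k) (constₚ-0# k)) n) (Σ<-congᵖ (suc n) shift) ⟩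
    0# + Σ< (suc n) (λ i → (Z *ₚ (G i *ₚ Z^ i)) n)                ≈⟨ +-identityˡ _ ⟩
    Σ< (suc n) (λ i → (Z *ₚ (G i *ₚ Z^ i)) n)                     ≈⟨ *ₚ-eval Z G n ⟨
    (Z *ₚ eval G) n                                               ∎
    where
    XG = 𝔻.varₚ 𝔻.*ₚ G
    shift : ∀ i → (XG (suc i) *ₚ Z^ (suc i)) n ≈ (Z *ₚ (G i *ₚ Z^ i)) n
    shift i = begin
      (XG (suc i) *ₚ (Z *ₚ Z^ i)) n    ≈⟨ *ₚ-congˡ (Z *ₚ Z^ i) (P𝔻.varₚ-*ₚ-suc G i) n ⟩
      (G i *ₚ (Z *ₚ Z^ i)) n           ≈⟨ *ₚ-assoc (G i) Z (Z^ i) n ⟨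
      ((G i *ₚ Z) *ₚ Z^ i) n           ≈⟨ *ₚ-congˡ (Z^ i) (*ₚ-comm (G i) Z) n ⟩
      ((Z *ₚ G i) *ₚ Z^ i) n           ≈⟨ *ₚ-assoc Z (G i) (Z^ i) n ⟩
      (Z *ₚ (G i *ₚ Z^ i)) n           ∎

  eval-at-0 : ∀ G → eval G 0 ≈ G 0 0
  eval-at-0 G = trans (+-identityˡ _) (trans (+-identityˡ _) (*-identityʳ _))

  eval-tailₚ : ∀ G → eval G ≈ₚ G 0 +ₚ (Z *ₚ eval (P𝔻.tailₚ G))
  eval-tailₚ G n = begin
    eval G n                                                        ≈⟨ eval-cong (P𝔻.constₚ+varₚ*tailₚ G) n ⟩
    eval (𝔻.constₚ (G 0) 𝔻.+ₚ (𝔻.varₚ 𝔻.*ₚ P𝔻.tailₚ G)) n            ≈⟨ eval-+ _ _ n ⟩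
    eval (𝔻.constₚ (G 0)) n + eval (𝔻.varₚ 𝔻.*ₚ P𝔻.tailₚ G) n        ≈⟨ +-cong (eval-constₚ (G 0) n) (eval-varₚ-*ₚ (P𝔻.tailₚ G) n) ⟩
    G 0 n + (Z *ₚ eval (P𝔻.tailₚ G)) n                              ∎

  eval-X-*ₚ : ∀ W Q → eval ((X- W) 𝔻.*ₚ Q) ≈ₚ (Z +ₚ -ₚ W) *ₚ eval Q
  eval-X-*ₚ W Q n = begin
    eval ((X- W) 𝔻.*ₚ Q) n                                          ≈⟨ eval-cong (P𝔻.*ₚ-distribʳ 𝔻.varₚ (𝔻.constₚ (-ₚ W)) Q) n ⟩
    eval ((𝔻.varₚ 𝔻.*ₚ Q) 𝔻.+ₚ (𝔻.constₚ (-ₚ W) 𝔻.*ₚ Q)) n          ≈⟨ eval-+ _ _ n ⟩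
    eval (𝔻.varₚ 𝔻.*ₚ Q) n + eval (𝔻.constₚ (-ₚ W) 𝔻.*ₚ Q) n        ≈⟨ +-cong (eval-varₚ-*ₚ Q n) (eval-constₚ-*ₚ (-ₚ W) Q n) ⟩
    (Z *ₚ eval Q) n + ((-ₚ W) *ₚ eval Q) n                          ≈⟨ *ₚ-distribʳ Z (-ₚ W) (eval Q) n ⟨
    ((Z +ₚ -ₚ W) *ₚ eval Q) n                                       ∎

  -- quotient G i = Σₖ G (i + 1 + k) Zᵏ, the coefficient of Xⁱ in (G(X) − G(Z)) / (X − Z).
  quotient : (ℕ → PS) → (ℕ → PS)
  quotient G zero    = eval (P𝔻.tailₚ G)
  quotient G (suc i) = quotient (P𝔻.tailₚ G) i

  quotient-suc : ∀ G i → quotient G i +ₚ ((-ₚ Z) *ₚ quotient G (suc i)) ≈ₚ G (suc i)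
  quotient-suc G zero n = begin
    eval G′ n + ((-ₚ Z) *ₚ eval G″) n                       ≈⟨ +-congʳ (eval-tailₚ G′ n) ⟩
    (G′ 0 n + (Z *ₚ eval G″) n) + ((-ₚ Z) *ₚ eval G″) n     ≈⟨ cancel (G′ 0) Z (eval G″) n ⟩
    G′ 0 n                                                 ∎
    where
    G′ = P𝔻.tailₚ G
    G″ = P𝔻.tailₚ G′
    open IntegerCoefficientSolver commutativeRingₚ using (solve; _:+_; _:*_; :-_; _:=_)
    cancel : ∀ g z e → (g +ₚ (z *ₚ e)) +ₚ ((-ₚ z) *ₚ e) ≈ₚ g
    cancel = solve 3 (λ g z e → (g :+ z :* e) :+ (:- z) :* e := g) (λ n → refl)
  quotient-suc G (suc i) = quotient-suc (P𝔻.tailₚ G) i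

  factor-theorem : ∀ G → eval G ≈ₚ constₚ 0# → G 𝔻.≈ₚ ((X- Z) 𝔻.*ₚ quotient G)
  factor-theorem G root i n = sym (begin
    ((X- Z) 𝔻.*ₚ Q) i n                                          ≈⟨ P𝔻.*ₚ-distribʳ 𝔻.varₚ (𝔻.constₚ (-ₚ Z)) Q i n ⟩
    (𝔻.varₚ 𝔻.*ₚ Q) i n + (𝔻.constₚ (-ₚ Z) 𝔻.*ₚ Q) i n           ≈⟨ +-congˡ (P𝔻.constₚ-*ₚ (-ₚ Z) Q i n) ⟩
    (𝔻.varₚ 𝔻.*ₚ Q) i n + ((-ₚ Z) *ₚ Q i) n                      ≈⟨ coefficient i ⟩
    G i n                                                        ∎)
    where
    Q = quotient G
    open import Algebra.Properties.Ring (CommutativeRing.ring commutativeRingₚ) using (-‿distribˡ-*)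
    open import Algebra.Properties.Ring ring using (+-inverseˡ-unique)
    coefficient : ∀ i → (𝔻.varₚ 𝔻.*ₚ Q) i n + ((-ₚ Z) *ₚ Q i) n ≈ G i n
    coefficient zero = begin
      (𝔻.varₚ 𝔻.*ₚ Q) 0 n + ((-ₚ Z) *ₚ Q 0) n   ≈⟨ +-cong (trans (P𝔻.varₚ-*ₚ-zero Q n) (constₚ-0# n)) (sym (-‿distribˡ-* Z (Q 0) n)) ⟩
      0# + - (Z *ₚ Q 0) n                        ≈⟨ +-identityˡ _ ⟩
      - (Z *ₚ Q 0) n                             ≈⟨ +-inverseˡ-unique _ _ G₀+ZQ₀≈0 ⟨
      G 0 n                                      ∎
      where
      G₀+ZQ₀≈0 : G 0 n + (Z *ₚ Q 0) n ≈ 0#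
      G₀+ZQ₀≈0 = trans (sym (eval-tailₚ G n)) (trans (root n) (constₚ-0# n))
    coefficient (suc i) = trans (+-congʳ (P𝔻.varₚ-*ₚ-suc Q i n)) (quotient-suc G i n)

module TwoRoots {c ℓ} (𝓡 : CommutativeRing c ℓ) (Z Z′ : Series.PS 𝓡)
                (Z₀≈0 : HasNoConstantTerm 𝓡 Z) (Z′₀≈0 : HasNoConstantTerm 𝓡 Z′) where
  open CommutativeRing 𝓡
  open Series 𝓡
  open PowerSeriesRing 𝓡
  open BivariatePowerSeries 𝓡 using (module 𝔻; module P𝔻; X-_)
  private
    module S  = Substitution 𝓡 Z Z₀≈0
    module S′ = Substitution 𝓡 Z′ Z′₀≈0
    module 𝔻ʳ = CommutativeRing P𝔻.commutativeRingₚ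

  cofactor : (ℕ → PS) → (ℕ → PS)
  cofactor P = S′.quotient (S.quotient P)

  factor-two-roots : ∀ v → v * (Z′ 1 - Z 1) ≈ 1# →
                     ∀ P → S.eval P ≈ₚ constₚ 0# → S′.eval P ≈ₚ constₚ 0# →
                     P 𝔻.≈ₚ ((X- Z) 𝔻.*ₚ ((X- Z′) 𝔻.*ₚ cofactor P))
  factor-two-roots v v*[Z′₁-Z₁]≈1 P root root′ = 𝔻ʳ.trans (S.factor-theorem P root) (𝔻ʳ.*-congˡ (S′.factor-theorem Q root′-Q))
    where
    Q = S.quotient P
    [Z′-Z]*eval′Q≈0 : ((Z′ +ₚ -ₚ Z) *ₚ S′.eval Q) ≈ₚ constₚ 0#
    [Z′-Z]*eval′Q≈0 n = trans (sym (S′.eval-X-*ₚ Z Q n))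
      (trans (S′.eval-cong (𝔻ʳ.sym (S.factor-theorem P root)) n) (root′ n))
    root′-Q : S′.eval Q ≈ₚ constₚ 0#
    root′-Q = *ₚ-cancel-order-one (Z′ +ₚ -ₚ Z) (S′.eval Q) v
      (trans (+-cong Z′₀≈0 (-‿cong Z₀≈0)) (-‿inverseʳ 0#)) v*[Z′₁-Z₁]≈1 [Z′-Z]*eval′Q≈0

  cofactor-at-0-0 : ∀ P → cofactor P 0 0 ≈ P 2 0
  cofactor-at-0-0 P = trans (S′.eval-at-0 (P𝔻.tailₚ (S.quotient P))) (S.eval-at-0 (P𝔻.tailₚ (P𝔻.tailₚ P)))

open import Defs
open PowerSeriesRing R
open BivariatePowerSeries R using (module 𝔻; module P𝔻; X-_; transpose; transpose-homomorphism)

private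
  module 𝒫 = CommutativeRing commutativeRingₚ

  ⊖a⊗⊖b~a⊗b : ∀ a b → (⊖ a) ⊗ (⊖ b) ~ a ⊗ b
  ⊖a⊗⊖b~a⊗b = solve 2 (λ a b → (:- a) :* (:- b) := a :* b) ~refl
    where
    open IntegerCoefficientSolver R using (solve; _:*_; :-_; _:=_)

σ-cong : ∀ {a b} → a ~ b → σ a ~ σ b
σ-cong ~refl             = ~refl
σ-cong (~sym e)          = ~sym (σ-cong e)
σ-cong (~trans e e′)     = ~trans (σ-cong e) (σ-cong e′)
σ-cong (⊕-cong e e′)     = ⊕-cong (σ-cong e) (σ-cong e′)
σ-cong (⊗-cong e e′)     = ⊗-cong (σ-cong e) (σ-cong e′)
σ-cong (⊖-cong e)        = ⊖-cong (σ-cong e)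
σ-cong (⊕-assoc a b c)   = ⊕-assoc (σ a) (σ b) (σ c)
σ-cong (⊕-idˡ a)         = ⊕-idˡ (σ a)
σ-cong (⊕-idʳ a)         = ⊕-idʳ (σ a)
σ-cong (⊖-invˡ a)        = ⊖-invˡ (σ a)
σ-cong (⊖-invʳ a)        = ⊖-invʳ (σ a)
σ-cong (⊕-comm a b)      = ⊕-comm (σ a) (σ b)
σ-cong (⊗-assoc a b c)   = ⊗-assoc (σ a) (σ b) (σ c)
σ-cong (⊗-idˡ a)         = ⊗-idˡ (σ a)
σ-cong (⊗-idʳ a)         = ⊗-idʳ (σ a)
σ-cong (distribˡ a b c)  = distribˡ (σ a) (σ b) (σ c)
σ-cong (distribʳ a b c)  = distribʳ (σ a) (σ b) (σ c)
σ-cong (⊗-comm a b)      = ⊗-comm (σ a) (σ b)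
σ-cong (con-+ p q)       = con-+ p q
σ-cong (con-* p q)       = con-* p q
σ-cong u-inv             = ~trans (⊖a⊗⊖b~a⊗b U Uinv) u-inv

σ-homomorphism : RingHom R R
σ-homomorphism = mkRingHomomorphism {𝓐 = R} {𝓑 = R} σ σ-cong
  (λ _ _ → ~refl) (λ _ _ → ~refl) (λ _ → ~refl) ~refl ~refl

private
  module σᶜ = CoefficientMap {𝓐 = R} {𝓑 = R} σ-homomorphism
  module σₚ = RingHomomorphism σᶜ.mapₚ

c : Tm
c = 𝟙 ⊕ (⊖ (U ⊗ U))

2y : PS
2y = constₚ two *ₚ varₚ

cy² : PS
cy² = (constₚ c *ₚ varₚ) *ₚ varₚ

σₚ-varₚ : σₚ.⟦ varₚ ⟧ ≈ₚ varₚ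
σₚ-varₚ zero          = ~refl
σₚ-varₚ (suc zero)    = ~refl
σₚ-varₚ (suc (suc n)) = ~refl

σₚ-2y : σₚ.⟦ 2y ⟧ ≈ₚ 2y
σₚ-2y = 𝒫.trans (σₚ.*-homo (constₚ two) varₚ)
                (𝒫.*-cong (σᶜ.⟦⟧-constₚ two) σₚ-varₚ)

σₚ-cy² : σₚ.⟦ cy² ⟧ ≈ₚ cy²
σₚ-cy² = 𝒫.trans (σₚ.*-homo (constₚ c *ₚ varₚ) varₚ)
  (𝒫.*-cong (𝒫.trans (σₚ.*-homo (constₚ c) varₚ)
                     (𝒫.*-cong (𝒫.trans (σᶜ.⟦⟧-constₚ c) (constₚ-cong σc≈c)) σₚ-varₚ))
            σₚ-varₚ)
  where
  σc≈c : σ c ~ c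
  σc≈c = ⊕-cong ~refl (⊖-cong (⊖a⊗⊖b~a⊗b U U))

σₚ-compₚ-Φ : ∀ F → σₚ.⟦ compₚ Φ F ⟧ ≈ₚ compₚ Φ σₚ.⟦ F ⟧
σₚ-compₚ-Φ F n = ~trans (σᶜ.mapₚ-compₚ Φ F n) (Σ<-congᵖ (suc n) (λ k → ⊗-cong (σΦ≈Φ k) ~refl))
  where
  σΦ≈Φ : ∀ k → σ (Φ k) ~ Φ k
  σΦ≈Φ zero    = ~refl
  σΦ≈Φ (suc k) = ~refl

σₚ-zEqn : ∀ F → σₚ.⟦ zEqn F ⟧ ≈ₚ zEqn σₚ.⟦ F ⟧
σₚ-zEqn F = 𝒫.trans (σₚ.+-homo (A +ₚ B) cy²) (𝒫.+-cong (𝒫.trans (σₚ.+-homo A B) (𝒫.+-cong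
  (𝒫.trans (σₚ.*-homo (F *ₚ F) (compₚ Φ F)) (𝒫.*-cong (σₚ.*-homo F F) (σₚ-compₚ-Φ F)))
  (𝒫.trans (σₚ.-‿homo (2y *ₚ F)) (𝒫.-‿cong (𝒫.trans (σₚ.*-homo 2y F) (𝒫.*-congʳ {σₚ.⟦ F ⟧} σₚ-2y))))))
  σₚ-cy²)
  where
  A = (F *ₚ F) *ₚ compₚ Φ F
  B = -ₚ (2y *ₚ F)

Φ̂ : ℕ → PS
Φ̂ i = constₚ (Φ i)

-- lhs = P / X²
P : ℕ → PS
P = ((𝔻.varₚ 𝔻.*ₚ (𝔻.varₚ 𝔻.*ₚ Φ̂)) 𝔻.+ₚ (𝔻.varₚ 𝔻.*ₚ 𝔻.constₚ (-ₚ 2y))) 𝔻.+ₚ 𝔻.constₚ cy²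

module _ (W : PS) (W₀≈0 : W 0 ~ 𝟘) where
  open Substitution R W W₀≈0

  eval-Φ̂ : eval Φ̂ ≈ₚ compₚ Φ W
  eval-Φ̂ n = ~trans (evalUpTo-at (suc n) Φ̂ n) (Σ<-congᵖ (suc n) (λ i → constₚ-*ₚ (Φ i) (Z^ i) n))

  eval-P : eval P ≈ₚ zEqn W
  eval-P = begin
    eval P
      ≈⟨ 𝒫.trans (eval-+ _ _) (𝒫.+-cong (eval-+ _ _) (eval-constₚ cy²)) ⟩
    (eval (𝔻.varₚ 𝔻.*ₚ (𝔻.varₚ 𝔻.*ₚ Φ̂)) +ₚ eval (𝔻.varₚ 𝔻.*ₚ 𝔻.constₚ (-ₚ 2y))) +ₚ cy²
      ≈⟨ 𝒫.+-congʳ (𝒫.+-cong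
           (𝒫.trans (eval-varₚ-*ₚ _) (𝒫.*-congˡ (𝒫.trans (eval-varₚ-*ₚ Φ̂) (𝒫.*-congˡ eval-Φ̂))))
           (𝒫.trans (eval-varₚ-*ₚ _) (𝒫.*-congˡ (eval-constₚ (-ₚ 2y))))) ⟩
    (W *ₚ (W *ₚ compₚ Φ W) +ₚ W *ₚ (-ₚ 2y)) +ₚ cy²
      ≈⟨ solve 4 (λ w k t c → (w :* (w :* k) :+ w :* (:- t)) :+ c := (w :* w :* k :+ :- (t :* w)) :+ c)
                 𝒫.refl W (compₚ Φ W) 2y cy² ⟩
    zEqn W ∎
    where
    open import Relation.Binary.Reasoning.Setoid 𝒫.setoid
    open IntegerCoefficientSolver commutativeRingₚ using (solve; _:+_; _:*_; :-_; _:=_)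

private
  module L  = LaurentSeriesRing R
  module 𝕃  = PowerSeriesRing L.commutativeRingL
  module 𝕃S = Series L.commutativeRingL
  module 𝕃ʳ = CommutativeRing 𝕃.commutativeRingₚ

Ψ-homomorphism : RingHom P𝔻.commutativeRingₚ 𝕃.commutativeRingₚ
Ψ-homomorphism = ringHomomorphism
  {M₁ = CommutativeRing.ring P𝔻.commutativeRingₚ} {M₂ = CommutativeRing.ring P𝔻.commutativeRingₚ}
  {M₃ = CommutativeRing.ring 𝕃.commutativeRingₚ}
  transpose-homomorphism (CoefficientMap.mapₚ L.fromPS-homomorphism)

ι-homomorphism : RingHom commutativeRingₚ 𝕃.commutativeRingₚ
ι-homomorphism = CoefficientMap.mapₚ (ringHomomorphism
  {M₁ = CommutativeRing.ring R} {M₂ = CommutativeRing.ring commutativeRingₚ}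
  {M₃ = CommutativeRing.ring L.commutativeRingL}
  constₚ-homomorphism L.fromPS-homomorphism)

private
  module Ψ = RingHomomorphism Ψ-homomorphism
  module ι = RingHomomorphism ι-homomorphism

x̄ : LPS
x̄ = constLP Xinv

ΣL<≡Σ< : ∀ n f → ΣL< n f ≡ 𝕃S.Σ< n f
ΣL<≡Σ< zero    f = ≡.refl
ΣL<≡Σ< (suc n) f = ≡.cong (_+L f n) (ΣL<≡Σ< n f)

*LP≈*ₚ : ∀ F G → (F *LP G) 𝕃ʳ.≈ (F 𝕃S.*ₚ G)
*LP≈*ₚ F G n i = CommutativeRing.reflexive R (≡.cong (λ A → coefL A i) (ΣL<≡Σ< (suc n) _))

constLP≈constₚ : ∀ A → constLP A 𝕃ʳ.≈ 𝕃S.constₚ A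
constLP≈constₚ A zero    = L.≈L-refl
constLP≈constₚ A (suc n) = L.≈L-refl

constLP-scalarL≈ι : ∀ a → constLP (scalarL a) 𝕃ʳ.≈ ι.⟦ constₚ a ⟧
constLP-scalarL≈ι a zero    = L.≈L-refl
constLP-scalarL≈ι a (suc n) = L.≈L-refl

yLP≈ι : yLP 𝕃ʳ.≈ ι.⟦ varₚ ⟧
yLP≈ι zero          = L.≈L-refl
yLP≈ι (suc zero)    = L.≈L-refl
yLP≈ι (suc (suc n)) = L.≈L-refl

fromPS≈ : ∀ {f g} → f ≈ₚ g → fromPS f ≈L fromPS g
fromPS≈ = RingHomomorphism.⟦⟧-cong L.fromPS-homomorphism

constLP-fromPS-Φ≈Ψ : constLP (fromPS Φ) 𝕃ʳ.≈ Ψ.⟦ Φ̂ ⟧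
constLP-fromPS-Φ≈Ψ zero    = L.≈L-refl
constLP-fromPS-Φ≈Ψ (suc n) = fromPS≈ constₚ-0#

Ψ-constₚ : ∀ f → Ψ.⟦ 𝔻.constₚ f ⟧ 𝕃ʳ.≈ ι.⟦ f ⟧
Ψ-constₚ f j = fromPS≈ at
  where
  at : ∀ i → 𝔻.constₚ f i j ~ constₚ (f j) i
  at zero    = ~refl
  at (suc i) = constₚ-0# j

Ψ-varₚ : Ψ.⟦ 𝔻.varₚ ⟧ 𝕃ʳ.≈ 𝕃S.constₚ (fromPS varₚ)
Ψ-varₚ zero    = fromPS≈ at
  where
  at : ∀ i → 𝔻.varₚ i 0 ~ varₚ i
  at zero          = ~refl
  at (suc zero)    = ~refl
  at (suc (suc i)) = ~refl
Ψ-varₚ (suc n) = fromPS≈ at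
  where
  at : ∀ i → 𝔻.varₚ i (suc n) ~ constₚ 𝟘 i
  at zero          = ~refl
  at (suc zero)    = ~refl
  at (suc (suc i)) = ~refl

Ψ-varₚ*x̄≈1 : Ψ.⟦ 𝔻.varₚ ⟧ 𝕃ʳ.* x̄ 𝕃ʳ.≈ 𝕃ʳ.1#
Ψ-varₚ*x̄≈1 = begin
  Ψ.⟦ 𝔻.varₚ ⟧ 𝕃ʳ.* x̄                          ≈⟨ 𝕃ʳ.*-cong Ψ-varₚ (constLP≈constₚ Xinv) ⟩
  𝕃S.constₚ (fromPS varₚ) 𝕃ʳ.* 𝕃S.constₚ Xinv   ≈⟨ Const.*-homo (fromPS varₚ) Xinv ⟨
  𝕃S.constₚ (fromPS varₚ *L Xinv)              ≈⟨ 𝕃.constₚ-cong L.fromPS-varₚ-*L-Xinv ⟩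
  𝕃ʳ.1#                                        ∎
  where
  open import Relation.Binary.Reasoning.Setoid 𝕃ʳ.setoid
  module Const = RingHomomorphism 𝕃.constₚ-homomorphism

private
  open InverseIdentities 𝕃.commutativeRingₚ
  a φ : LPS
  a = Ψ.⟦ 𝔻.varₚ ⟧
  φ = Ψ.⟦ Φ̂ ⟧

lhs≈ : lhs 𝕃ʳ.≈ (φ 𝕃ʳ.- ι.⟦ 2y ⟧ 𝕃ʳ.* x̄) 𝕃ʳ.+ ι.⟦ cy² ⟧ 𝕃ʳ.* (x̄ 𝕃ʳ.* x̄)
lhs≈ = begin
  (constLP (fromPS Φ) 𝕃ʳ.- (2̂ *LP yLP) *LP x̄) 𝕃ʳ.+ ((ĉ *LP yLP) *LP yLP) *LP constLP (Xinv *L Xinv)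
    ≈⟨ 𝕃ʳ.+-cong (𝕃ʳ.+-congˡ {constLP (fromPS Φ)} (𝕃ʳ.-‿cong (*LP≈*ₚ (2̂ *LP yLP) x̄)))
                 (*LP≈*ₚ ((ĉ *LP yLP) *LP yLP) (constLP (Xinv *L Xinv))) ⟩
  (constLP (fromPS Φ) 𝕃ʳ.- (2̂ *LP yLP) 𝕃ʳ.* x̄) 𝕃ʳ.+ ((ĉ *LP yLP) *LP yLP) 𝕃ʳ.* constLP (Xinv *L Xinv)
    ≈⟨ 𝕃ʳ.+-cong (𝕃ʳ.+-cong constLP-fromPS-Φ≈Ψ (𝕃ʳ.-‿cong (𝕃ʳ.*-congʳ {x̄} 2y≈))) (𝕃ʳ.*-cong cy²≈ x̄x̄≈) ⟩
  (φ 𝕃ʳ.- ι.⟦ 2y ⟧ 𝕃ʳ.* x̄) 𝕃ʳ.+ ι.⟦ cy² ⟧ 𝕃ʳ.* (x̄ 𝕃ʳ.* x̄) ∎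
  where
  open import Relation.Binary.Reasoning.Setoid 𝕃ʳ.setoid
  2̂ ĉ : LPS
  2̂ = constLP (scalarL two)
  ĉ = constLP (scalarL c)
  ι-* : ∀ F G f g → F 𝕃ʳ.≈ ι.⟦ f ⟧ → G 𝕃ʳ.≈ ι.⟦ g ⟧ → F *LP G 𝕃ʳ.≈ ι.⟦ f *ₚ g ⟧
  ι-* F G f g e e′ = begin
    F *LP G                 ≈⟨ *LP≈*ₚ F G ⟩
    F 𝕃ʳ.* G                ≈⟨ 𝕃ʳ.*-cong e e′ ⟩
    ι.⟦ f ⟧ 𝕃ʳ.* ι.⟦ g ⟧    ≈⟨ ι.*-homo f g ⟨
    ι.⟦ f *ₚ g ⟧            ∎
  2y≈ : 2̂ *LP yLP 𝕃ʳ.≈ ι.⟦ 2y ⟧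
  2y≈ = ι-* 2̂ yLP (constₚ two) varₚ (constLP-scalarL≈ι two) yLP≈ι
  cy²≈ : (ĉ *LP yLP) *LP yLP 𝕃ʳ.≈ ι.⟦ cy² ⟧
  cy²≈ = ι-* (ĉ *LP yLP) yLP (constₚ c *ₚ varₚ) varₚ (ι-* ĉ yLP (constₚ c) varₚ (constLP-scalarL≈ι c) yLP≈ι) yLP≈ι
  x̄x̄≈ : constLP (Xinv *L Xinv) 𝕃ʳ.≈ x̄ 𝕃ʳ.* x̄
  x̄x̄≈ = begin
    constLP (Xinv *L Xinv)                         ≈⟨ constLP≈constₚ (Xinv *L Xinv) ⟩
    𝕃S.constₚ (Xinv *L Xinv)                       ≈⟨ RingHomomorphism.*-homo 𝕃.constₚ-homomorphism Xinv Xinv ⟩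
    𝕃S.constₚ Xinv 𝕃ʳ.* 𝕃S.constₚ Xinv             ≈⟨ 𝕃ʳ.*-cong (constLP≈constₚ Xinv) (constLP≈constₚ Xinv) ⟨
    x̄ 𝕃ʳ.* x̄                                       ∎

Ψ-P : Ψ.⟦ P ⟧ 𝕃ʳ.≈ (a 𝕃ʳ.* (a 𝕃ʳ.* φ) 𝕃ʳ.+ a 𝕃ʳ.* (𝕃ʳ.- ι.⟦ 2y ⟧)) 𝕃ʳ.+ ι.⟦ cy² ⟧
Ψ-P = begin
  Ψ.⟦ (X·XΦ̂ 𝔻.+ₚ X·−2y) 𝔻.+ₚ 𝔻.constₚ cy² ⟧
    ≈⟨ Ψ.+-homo (X·XΦ̂ 𝔻.+ₚ X·−2y) (𝔻.constₚ cy²) ⟩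
  Ψ.⟦ X·XΦ̂ 𝔻.+ₚ X·−2y ⟧ 𝕃ʳ.+ Ψ.⟦ 𝔻.constₚ cy² ⟧
    ≈⟨ 𝕃ʳ.+-cong (Ψ.+-homo X·XΦ̂ X·−2y) (Ψ-constₚ cy²) ⟩
  (Ψ.⟦ X·XΦ̂ ⟧ 𝕃ʳ.+ Ψ.⟦ X·−2y ⟧) 𝕃ʳ.+ ι.⟦ cy² ⟧
    ≈⟨ 𝕃ʳ.+-congʳ (𝕃ʳ.+-cong
         (𝕃ʳ.trans (Ψ.*-homo 𝔻.varₚ (𝔻.varₚ 𝔻.*ₚ Φ̂)) (𝕃ʳ.*-congˡ {a} (Ψ.*-homo 𝔻.varₚ Φ̂)))
         (𝕃ʳ.trans (Ψ.*-homo 𝔻.varₚ (𝔻.constₚ (-ₚ 2y)))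
                   (𝕃ʳ.*-congˡ {a} (𝕃ʳ.trans (Ψ-constₚ (-ₚ 2y)) (ι.-‿homo 2y))))) ⟩
  (a 𝕃ʳ.* (a 𝕃ʳ.* φ) 𝕃ʳ.+ a 𝕃ʳ.* (𝕃ʳ.- ι.⟦ 2y ⟧)) 𝕃ʳ.+ ι.⟦ cy² ⟧ ∎
  where
  open import Relation.Binary.Reasoning.Setoid 𝕃ʳ.setoid
  X·XΦ̂ X·−2y : ℕ → PS
  X·XΦ̂ = 𝔻.varₚ 𝔻.*ₚ (𝔻.varₚ 𝔻.*ₚ Φ̂)
  X·−2y = 𝔻.varₚ 𝔻.*ₚ 𝔻.constₚ (-ₚ 2y)

Ψ-X- : ∀ W → Ψ.⟦ X- W ⟧ 𝕃ʳ.≈ a 𝕃ʳ.- ι.⟦ W ⟧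
Ψ-X- W = 𝕃ʳ.trans (Ψ.+-homo 𝔻.varₚ (𝔻.constₚ (-ₚ W)))
                  (𝕃ʳ.+-congˡ {a} (𝕃ʳ.trans (Ψ-constₚ (-ₚ W)) (ι.-‿homo W)))

oneMinusOverX≈ : ∀ W → oneMinusOverX W 𝕃ʳ.≈ 𝕃ʳ.1# 𝕃ʳ.- ι.⟦ W ⟧ 𝕃ʳ.* x̄
oneMinusOverX≈ W = 𝕃ʳ.+-cong (constLP≈constₚ (scalarL 𝟙)) (𝕃ʳ.-‿cong (*LP≈*ₚ (ιy W) x̄))

lhs≈Ψ⟦P⟧x̄² : lhs 𝕃ʳ.≈ Ψ.⟦ P ⟧ 𝕃ʳ.* (x̄ 𝕃ʳ.* x̄)
lhs≈Ψ⟦P⟧x̄² = begin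
  lhs
    ≈⟨ lhs≈ ⟩
  (φ 𝕃ʳ.- ι.⟦ 2y ⟧ 𝕃ʳ.* x̄) 𝕃ʳ.+ ι.⟦ cy² ⟧ 𝕃ʳ.* (x̄ 𝕃ʳ.* x̄)
    ≈⟨ ar≈1⇒φ-pr+krr≈[aaφ-ap+k]rr a x̄ φ ι.⟦ 2y ⟧ ι.⟦ cy² ⟧ Ψ-varₚ*x̄≈1 ⟩
  ((a 𝕃ʳ.* (a 𝕃ʳ.* φ) 𝕃ʳ.+ a 𝕃ʳ.* (𝕃ʳ.- ι.⟦ 2y ⟧)) 𝕃ʳ.+ ι.⟦ cy² ⟧) 𝕃ʳ.* (x̄ 𝕃ʳ.* x̄)
    ≈⟨ 𝕃ʳ.*-congʳ {x̄ 𝕃ʳ.* x̄} Ψ-P ⟨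
  Ψ.⟦ P ⟧ 𝕃ʳ.* (x̄ 𝕃ʳ.* x̄) ∎
  where
  open import Relation.Binary.Reasoning.Setoid 𝕃ʳ.setoid

lhs-factorisation : ∀ W W′ Q → P 𝔻.≈ₚ ((X- W) 𝔻.*ₚ ((X- W′) 𝔻.*ₚ Q)) →
  lhs ≈LP ((oneMinusOverX W *LP oneMinusOverX W′) *LP ιXy (transpose Q))
lhs-factorisation W W′ Q P≈ = begin
  lhs
    ≈⟨ lhs≈Ψ⟦P⟧x̄² ⟩
  Ψ.⟦ P ⟧ 𝕃ʳ.* (x̄ 𝕃ʳ.* x̄)
    ≈⟨ 𝕃ʳ.*-congʳ {x̄ 𝕃ʳ.* x̄} (Ψ.⟦⟧-cong P≈) ⟩
  Ψ.⟦ (X- W) 𝔻.*ₚ ((X- W′) 𝔻.*ₚ Q) ⟧ 𝕃ʳ.* (x̄ 𝕃ʳ.* x̄)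
    ≈⟨ 𝕃ʳ.*-congʳ {x̄ 𝕃ʳ.* x̄} factors ⟩
  ((a 𝕃ʳ.- ι.⟦ W ⟧) 𝕃ʳ.* ((a 𝕃ʳ.- ι.⟦ W′ ⟧) 𝕃ʳ.* Ψ.⟦ Q ⟧)) 𝕃ʳ.* (x̄ 𝕃ʳ.* x̄)
    ≈⟨ ar≈1⇒[a-u][[a-v]t]rr≈[1-ur][1-vr]t a x̄ ι.⟦ W ⟧ ι.⟦ W′ ⟧ Ψ.⟦ Q ⟧ Ψ-varₚ*x̄≈1 ⟩
  ((𝕃ʳ.1# 𝕃ʳ.- ι.⟦ W ⟧ 𝕃ʳ.* x̄) 𝕃ʳ.* (𝕃ʳ.1# 𝕃ʳ.- ι.⟦ W′ ⟧ 𝕃ʳ.* x̄)) 𝕃ʳ.* Ψ.⟦ Q ⟧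
    ≈⟨ 𝕃ʳ.*-congʳ {Ψ.⟦ Q ⟧} (𝕃ʳ.*-cong (oneMinusOverX≈ W) (oneMinusOverX≈ W′)) ⟨
  (oneMinusOverX W 𝕃ʳ.* oneMinusOverX W′) 𝕃ʳ.* Ψ.⟦ Q ⟧
    ≈⟨ 𝕃ʳ.*-congʳ {Ψ.⟦ Q ⟧} (*LP≈*ₚ (oneMinusOverX W) (oneMinusOverX W′)) ⟨
  (oneMinusOverX W *LP oneMinusOverX W′) 𝕃ʳ.* Ψ.⟦ Q ⟧
    ≈⟨ *LP≈*ₚ (oneMinusOverX W *LP oneMinusOverX W′) (ιXy (transpose Q)) ⟨
  (oneMinusOverX W *LP oneMinusOverX W′) *LP ιXy (transpose Q) ∎
  where
  open import Relation.Binary.Reasoning.Setoid 𝕃ʳ.setoid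
  factors : Ψ.⟦ (X- W) 𝔻.*ₚ ((X- W′) 𝔻.*ₚ Q) ⟧ 𝕃ʳ.≈ (a 𝕃ʳ.- ι.⟦ W ⟧) 𝕃ʳ.* ((a 𝕃ʳ.- ι.⟦ W′ ⟧) 𝕃ʳ.* Ψ.⟦ Q ⟧)
  factors = begin
    Ψ.⟦ (X- W) 𝔻.*ₚ ((X- W′) 𝔻.*ₚ Q) ⟧               ≈⟨ Ψ.*-homo (X- W) ((X- W′) 𝔻.*ₚ Q) ⟩
    Ψ.⟦ X- W ⟧ 𝕃ʳ.* Ψ.⟦ (X- W′) 𝔻.*ₚ Q ⟧              ≈⟨ 𝕃ʳ.*-cong (Ψ-X- W) (Ψ.*-homo (X- W′) Q) ⟩
    (a 𝕃ʳ.- ι.⟦ W ⟧) 𝕃ʳ.* (Ψ.⟦ X- W′ ⟧ 𝕃ʳ.* Ψ.⟦ Q ⟧) ≈⟨ 𝕃ʳ.*-congˡ {a 𝕃ʳ.- ι.⟦ W ⟧} (𝕃ʳ.*-congʳ {Ψ.⟦ Q ⟧} (Ψ-X- W′)) ⟩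
    (a 𝕃ʳ.- ι.⟦ W ⟧) 𝕃ʳ.* ((a 𝕃ʳ.- ι.⟦ W′ ⟧) 𝕃ʳ.* Ψ.⟦ Q ⟧) ∎

P₂₀≈1 : P 2 0 ~ 𝟙
P₂₀≈1 = ~trans (⊕-idʳ _) (~trans (⊕-cong X²Φ̂ X·−2y) (⊕-idʳ 𝟙))
  where
  X²Φ̂ : (𝔻.varₚ 𝔻.*ₚ (𝔻.varₚ 𝔻.*ₚ Φ̂)) 2 0 ~ 𝟙
  X²Φ̂ = ~trans (P𝔻.varₚ-*ₚ-suc (𝔻.varₚ 𝔻.*ₚ Φ̂) 1 0) (P𝔻.varₚ-*ₚ-suc Φ̂ 0 0)
  X·−2y : (𝔻.varₚ 𝔻.*ₚ 𝔻.constₚ (-ₚ 2y)) 2 0 ~ 𝟘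
  X·−2y = P𝔻.varₚ-*ₚ-suc (𝔻.constₚ (-ₚ 2y)) 1 0

½u⁻¹*[σ[1-u]-[1-u]]≈1 : (con ½ ⊗ Uinv) ⊗ (σ (𝟙 ⊕ (⊖ U)) ⊕ (⊖ (𝟙 ⊕ (⊖ U)))) ~ 𝟙
½u⁻¹*[σ[1-u]-[1-u]]≈1 = ~trans
  (solve 4 (λ h v u o → (h :* v) :* ((o :+ :- (:- u)) :+ :- (o :+ :- u)) := (h :+ h) :* (u :* v))
     ~refl (con ½) Uinv U 𝟙)
  (~trans (⊗-cong (~sym (con-+ ½ ½)) u-inv) (⊗-idʳ _))
  where
  open IntegerCoefficientSolver R using (solve; _:+_; _:*_; :-_; _:=_)

lemma4 : (Z : PS)
    → Z 0 ~ 𝟘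
    → Z 1 ~ 𝟙 ⊕ (⊖ U)
    → zEqn Z ≈ₚ constₚ 𝟘
    → Σ (ℕ → ℕ → Tm) (λ T →
        (T 0 0 ~ 𝟙)
        × (lhs ≈LP ((oneMinusOverX Z *LP oneMinusOverX (λ n → σ (Z n))) *LP ιXy T)))
lemma4 Z Z₀≈0 Z₁≈1-u zEqn≈0 =
  transpose (cofactor P) , ~trans (cofactor-at-0-0 P) P₂₀≈1 ,
  lhs-factorisation Z Z′ (cofactor P) (factor-two-roots (con ½ ⊗ Uinv) ½u⁻¹*[Z′₁-Z₁]≈1 P root root′)
  where
  Z′ : PS
  Z′ = σₚ.⟦ Z ⟧
  open TwoRoots R Z Z′ Z₀≈0 (σ-cong Z₀≈0)
  ½u⁻¹*[Z′₁-Z₁]≈1 : (con ½ ⊗ Uinv) ⊗ (Z′ 1 ⊕ (⊖ Z 1)) ~ 𝟙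
  ½u⁻¹*[Z′₁-Z₁]≈1 = ~trans (⊗-cong ~refl (⊕-cong (σ-cong Z₁≈1-u) (⊖-cong Z₁≈1-u))) ½u⁻¹*[σ[1-u]-[1-u]]≈1
  root : Substitution.eval R Z Z₀≈0 P ≈ₚ constₚ 𝟘
  root = 𝒫.trans (eval-P Z Z₀≈0) zEqn≈0
  root′ : Substitution.eval R Z′ (σ-cong Z₀≈0) P ≈ₚ constₚ 𝟘
  root′ = 𝒫.trans (eval-P Z′ (σ-cong Z₀≈0))
            (𝒫.trans (𝒫.sym (σₚ-zEqn Z)) (𝒫.trans (σₚ.⟦⟧-cong zEqn≈0) σₚ.0#-homo))
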